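{- Let $\pi=\langle \pi_1\ \cdots\ \pi_n\rangle$ be any signed permutation of size $n$. Then $$psrd(\pi)\ \geq\ n+1+c(BG(\pi))-2c_1(BG(\pi))-\begin{cases}0 & \text{if } \pi_1=1,\\ 2 & \text{otherwise.}\end{cases}$$
   Context: A signed permutation of size $n$ is a sequence $\pi=\langle\pi_1\ \cdots\ \pi_n\rangle$ of nonzero integers such that $(|\pi_1|,\ldots,|\pi_n|)$ is a permutation of $\{1,\ldots,n\}$; the identity is $\iota=\langle 1\ 2\ \cdots\ n\rangle$ (all signs positive). "$\pi_1=1$" means the first entry is $1$ with positive sign. For $1\le j\le n$, the prefix signed reversal $\overline{\rho}(1,j)$ transforms $\pi$ into $\langle -\pi_j\ -\pi_{j-1}\ \cdots\ -\pi_1\ \pi_{j+1}\ \cdots\ \pi_n\rangle$. $psrd(\pi)$ is the minimum number of prefix signed reversals whose successive application transforms $\pi$ into $\iota$. Breakpoint graph: let $\pi'=(\pi'_0,\pi'_1,\ldots,\pi'_{2n+1})$ with $\pi'_0=0$, $\pi'_{2n+1}=2n+1$ and, for $1\le i\le n$, $(\pi'_{2i-1},\pi'_{2i})=(2\pi_i-1,2\pi_i)$ if $\pi_i>0$ and $(2|\pi_i|,2|\pi_i|-1)$ if $\pi_i<0$. $BG(\pi)$ has one vertex for each position $p\in\{0,\ldots,2n+1\}$ (labelled $\pi'_p$); its black edges join the vertices at positions $2i$ and $2i+1$ for $0\le i\le n$, and its grey edges join the vertices labelled $2k$ and $2k+1$ for $0\le k\le n$. Every vertex has exactly one black and one grey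 edge, so $BG(\pi)$ decomposes uniquely into alternating cycles. $c(BG(\pi))$ is the number of these cycles; the length of a cycle is its number of black edges; $c_1(BG(\pi))$ is the number of cycles of length $1$. -}

module Defs where

open import Data.Nat as ℕ using (ℕ; zero; suc; _≤_; _≤ᵇ_; _≡ᵇ_)
open import Data.Integer as ℤ using (ℤ; +_; -_; ∣_∣)
open import Data.Bool using (Bool; true; false; _∧_; if_then_else_)
open import Data.List using (List; []; _∷_; _++_; map; reverse; take; drop; length; upTo; concatMap; filter; head; lookup)
open import Data.List.Relation.Binary.Permutation.Propositional using (_↭_)
open import Data.List.Relation.Unary.All using (All)
open import Data.Maybe using (Maybe; just; nothing)
open import Data.Product using (_×_)
open import Relation.Binary.PropositionalEquality using (_≡_; _≢_)
open import Relation.Nullary.Decidable using (yes; no)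

oneTo : ℕ → List ℕ
oneTo n = map suc (upTo n)

IsSignedPerm : ℕ → List ℤ → Set
IsSignedPerm n π = length π ≡ n × All (λ x → x ≢ + 0) π × map ∣_∣ π ↭ oneTo n

ι : ℕ → List ℤ
ι n = map +_ (oneTo n)

prefixRev : ℕ → List ℤ → List ℤ
prefixRev j π = map -_ (reverse (take j π)) ++ drop j π

applyAll : List ℕ → List ℤ → List ℤ
applyAll []       π = π
applyAll (j ∷ js) π = applyAll js (prefixRev j π)

-- js is a sequence of prefix signed reversals (1 ≤ j ≤ n each) sorting π into ι.
-- psrd(π) is the minimum length of such a sequence.
IsSortingSeq : ℕ → List ℤ → List ℕ → Set
IsSortingSeq n π js = All (λ j → 1 ≤ j × j ≤ n) js × applyAll js π ≡ ι n

pairFlip : ℕ → ℕ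
pairFlip zero = 1
pairFlip (suc zero) = 0
pairFlip (suc (suc x)) = suc (suc (pairFlip x))

extend : ℕ → List ℤ → List ℕ
extend n π = 0 ∷ concatMap ext π ++ (suc (2 ℕ.* n) ∷ [])
  where
  ext : ℤ → List ℕ
  ext (+ k)      = (2 ℕ.* k ℕ.∸ 1) ∷ (2 ℕ.* k) ∷ []
  ext ℤ.-[1+ k ] = (2 ℕ.* suc k) ∷ (2 ℕ.* suc k ℕ.∸ 1) ∷ []

allᵇ : {A : Set} → (A → Bool) → List A → Bool
allᵇ f [] = true
allᵇ f (x ∷ xs) = f x ∧ allᵇ f xs

-- label at position p (default 0 outside the range; never used there)
at : List ℕ → ℕ → ℕ
at []       _       = 0
at (x ∷ xs) zero    = x
at (x ∷ xs) (suc p) = at xs p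

-- position of label l (default: length of list; never used for valid π)
indexOf : ℕ → List ℕ → ℕ
indexOf l []       = 0
indexOf l (x ∷ xs) = if x ≡ᵇ l then 0 else suc (indexOf l xs)

module BG (n : ℕ) (π : List ℤ) where
  π' : List ℕ
  π' = extend n π

  N : ℕ
  N = 2 ℕ.+ 2 ℕ.* n

  black : ℕ → ℕ
  black p = pairFlip p

  -- grey edges join the vertices labelled 2k and 2k+1
  grey : ℕ → ℕ
  grey p = indexOf (pairFlip (at π' p)) π'

  σ : ℕ → ℕ
  σ p = grey (black p)

  σ^ : ℕ → ℕ → ℕ
  σ^ zero    p = p
  σ^ (suc m) p = σ (σ^ m p)

  -- p is the smallest position on its alternating cycle: the cycle through p
  -- consists of the vertices σᵐ p and black (σᵐ p) (m < N).
  isCycleRep : ℕ → Bool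
  isCycleRep p = allᵇ (λ m → (p ≤ᵇ σ^ m p) ∧ (p ≤ᵇ black (σ^ m p))) (upTo N)

  -- the cycle through p has length 1 (exactly one black edge)
  isLength1 : ℕ → Bool
  isLength1 p = σ p ≡ᵇ p

  c : ℕ
  c = length (filter (λ p → isCycleRep p Data.Bool.≟ true) (upTo N))

  c₁ : ℕ
  c₁ = length (filter (λ p → (isCycleRep p ∧ isLength1 p) Data.Bool.≟ true) (upTo N))

firstCorr : List ℤ → ℤ
firstCorr (x ∷ _) with x ℤ.≟ + 1
... | yes _ = + 0
... | no  _ = + 2
firstCorr [] = + 2

lowerBound : ℕ → List ℤ → ℤ
lowerBound n π = + (n ℕ.+ 1 ℕ.+ BG.c n π) ℤ.- + (2 ℕ.* BG.c₁ n π) ℤ.- firstCorr π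

module Submission where

-- BG(π) is viewed as two involutions on the 2n+2 positions
-- of π': `black` (the fixed pairs {2i, 2i+1}) and `grey` (joining the
-- positions of the labels 2k and 2k+1).  Write z(π) = 1 if the cycle through
-- position 0 has length one and 0 otherwise.  We show, by induction along a
-- sorting sequence js,
--     n + 1 + c(π) + 2 z(π) ≤ length js + 2 c₁(π) + 2.
-- For π = ι all n + 1 cycles have length one and z = 1.  A prefix reversal
-- ρ̄(1,j) acts on π' by reversing the positions 1,…,2j (`revPos j`); after
-- relabelling by this involution, BG(ρ̄(1,j) π) is BG(π) with its black edges
-- {0,1}, {2j,2j+1} exchanged for {0,2j}, {1,2j+1}.  Relabelling preserves the
-- cycle counts, and the exchange only touches the cycles through 0 and 2j,
-- so c - 2c₁ + 2z decreases by at most one per reversal.  Finally firstCorr π is 0 only if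
-- π₁ = 1, in which case z(π) = 1, which turns the inequality into the bound.

module Booleans where

  open import Data.Nat
  open import Data.Nat.Properties using (≡ᵇ⇒≡; ≤ᵇ⇒≤; ≤⇒≤ᵇ)
  open import Data.Bool using (Bool; true; false; T; _∧_; _∨_; not)
  open import Data.Bool.Properties using (T-≡; ∧-zeroʳ)
  open import Data.Empty using (⊥-elim)
  open import Relation.Binary.PropositionalEquality
  open import Function using (Equivalence)

  T⇒≡ : ∀ {x} → T x → x ≡ true
  T⇒≡ = Equivalence.to T-≡

  ∧-intro : ∀ {x y} → x ≡ true → y ≡ true → (x ∧ y) ≡ true
  ∧-intro refl refl = refl

  ∧-elimˡ : ∀ {x y} → (x ∧ y) ≡ true → x ≡ true
  ∧-elimˡ {true} _ = refl

  ∧-elimʳ : ∀ {x y} → (x ∧ y) ≡ true → y ≡ true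
  ∧-elimʳ {true} e = e

  ∨-introˡ : ∀ {x y} → x ≡ true → (x ∨ y) ≡ true
  ∨-introˡ refl = refl

  ∨-introʳ : ∀ {x y} → y ≡ true → (x ∨ y) ≡ true
  ∨-introʳ {true}  refl = refl
  ∨-introʳ {false} refl = refl

  bool-ext : ∀ {x y : Bool} → (x ≡ true → y ≡ true) → (y ≡ true → x ≡ true) → x ≡ y
  bool-ext {false} {false} _ _ = refl
  bool-ext {false} {true}  _ h = h refl
  bool-ext {true}          f _ = sym (f refl)

  bool-ext-false : ∀ {x y : Bool} → (x ≡ false → y ≡ false) → (y ≡ false → x ≡ false) → x ≡ y
  bool-ext-false {false} {false} _ _ = refl
  bool-ext-false {false} {true}  f _ = sym (f refl)
  bool-ext-false {true}  {false} _ h = h refl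
  bool-ext-false {true}  {true}  _ _ = refl

  ∧-not-cong : ∀ {r r' A A' : Bool} → A ≡ A' → (A ≡ false → r ≡ r') → (r ∧ not A) ≡ (r' ∧ not A')
  ∧-not-cong {r} {r'} {true}  {true}  refl _ = trans (∧-zeroʳ r) (sym (∧-zeroʳ r'))
  ∧-not-cong          {A = false} {false} refl h = cong (_∧ true) (h refl)

  ≡ᵇ-refl : ∀ m → (m ≡ᵇ m) ≡ true
  ≡ᵇ-refl zero    = refl
  ≡ᵇ-refl (suc m) = ≡ᵇ-refl m

  ≡ᵇ-sound : ∀ {m n} → (m ≡ᵇ n) ≡ true → m ≡ n
  ≡ᵇ-sound {m} {n} e = ≡ᵇ⇒≡ m n (Equivalence.from T-≡ e)

  ≡ᵇ-false : ∀ {m n} → m ≢ n → (m ≡ᵇ n) ≡ false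
  ≡ᵇ-false {m} {n} m≢n with m ≡ᵇ n in e
  ... | true  = ⊥-elim (m≢n (≡ᵇ-sound e))
  ... | false = refl

  ≤ᵇ-complete : ∀ {m n} → m ≤ n → (m ≤ᵇ n) ≡ true
  ≤ᵇ-complete m≤n = T⇒≡ (≤⇒≤ᵇ m≤n)

  ≤ᵇ-sound : ∀ {m n} → (m ≤ᵇ n) ≡ true → m ≤ n
  ≤ᵇ-sound {m} {n} e = ≤ᵇ⇒≤ m n (Equivalence.from T-≡ e)

module Counting where

  open import Data.Nat
  open import Data.Nat.Properties
  open import Data.Bool using (Bool; true; false; _∧_; _∨_; not; if_then_else_)
  open import Data.Bool.Properties using (∧-identityʳ; ¬-not)
  import Data.Bool as 𝔹
  open import Data.List using ([]; _∷_; length; filter; upTo; applyUpTo)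
  open import Data.Product using (_×_; _,_; proj₁; proj₂; ∃)
  open import Data.Sum using (_⊎_; inj₁; inj₂)
  open import Data.Empty using (⊥; ⊥-elim)
  open import Relation.Nullary using (yes; no)
  open import Relation.Binary.Definitions using (tri<; tri≈; tri>)
  open import Relation.Binary.PropositionalEquality
  open import Function using (_∘_)
  open import Algebra.Properties.CommutativeSemigroup +-commutativeSemigroup using (interchange; xy∙z≈xz∙y)
  open import Defs using (allᵇ)
  open Booleans

  𝟙 : Bool → ℕ
  𝟙 true  = 1
  𝟙 false = 0

  count : ℕ → (ℕ → Bool) → ℕ
  count zero    P = 0
  count (suc N) P = count N P + 𝟙 (P N)

  count-suc : ∀ N P → count (suc N) P ≡ 𝟙 (P 0) + count N (P ∘ suc)
  count-suc zero    P = +-comm 0 (𝟙 (P 0))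
  count-suc (suc N) P rewrite count-suc N P =
    +-assoc (𝟙 (P 0)) (count N (P ∘ suc)) (𝟙 (P (suc N)))

  count-filter : ∀ N (P : ℕ → Bool) →
    length (filter (λ p → P p 𝔹.≟ true) (upTo N)) ≡ count N P
  count-filter N P = along N (λ p → p)
    where
    along : ∀ N f → length (filter (λ p → P p 𝔹.≟ true) (applyUpTo f N)) ≡ count N (P ∘ f)
    along zero    f = refl
    along (suc N) f rewrite count-suc N (P ∘ f) with P (f 0)
    ... | true  = cong suc (along N (f ∘ suc))
    ... | false = along N (f ∘ suc)

  count-ext : ∀ N P Q → (∀ p → p < N → P p ≡ Q p) → count N P ≡ count N Q
  count-ext zero    P Q h = refl
  count-ext (suc N) P Q h =
    cong₂ _+_ (count-ext N P Q (λ p p<N → h p (m<n⇒m<1+n p<N))) (cong 𝟙 (h N ≤-refl))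

  count-all : ∀ N → count N (λ _ → true) ≡ N
  count-all zero    = refl
  count-all (suc N) = trans (cong (_+ 1) (count-all N)) (+-comm N 1)

  count-none : ∀ N P → (∀ p → p < N → P p ≡ false) → count N P ≡ 0
  count-none zero    P h = refl
  count-none (suc N) P h
    rewrite count-none N P (λ p p<N → h p (m<n⇒m<1+n p<N)) | h N ≤-refl = refl

  𝟙-split : ∀ x y → 𝟙 x ≡ 𝟙 (x ∧ y) + 𝟙 (x ∧ not y)
  𝟙-split false y     = refl
  𝟙-split true  false = refl
  𝟙-split true  true  = refl

  count-split : ∀ N P (Q : ℕ → Bool) →
    count N P ≡ count N (λ p → P p ∧ Q p) + count N (λ p → P p ∧ not (Q p))
  count-split zero    P Q = refl
  count-split (suc N) P Q rewrite count-split N P Q | 𝟙-split (P N) (Q N) =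
    interchange (count N (λ p → P p ∧ Q p)) (count N (λ p → P p ∧ not (Q p)))
                (𝟙 (P N ∧ Q N)) (𝟙 (P N ∧ not (Q N)))

  count-remove : ∀ M Q t → t < M → Q t ≡ true →
    count M (λ p → Q p ∧ not (p ≡ᵇ t)) + 1 ≡ count M Q
  count-remove (suc M) Q t t<1+M Qt with t ≟ M
  ... | yes refl rewrite Qt | ≡ᵇ-refl t =
    cong (_+ 1) (trans (+-identityʳ _) (count-ext t _ Q below))
    where
    below : ∀ p → p < t → (Q p ∧ not (p ≡ᵇ t)) ≡ Q p
    below p p<t rewrite ≡ᵇ-false (<⇒≢ p<t) = ∧-identityʳ (Q p)
  ... | no t≢M = begin
    count M Q' + 𝟙 (Q' M) + 1 ≡⟨ cong (λ b → count M Q' + 𝟙 b + 1) Q'M≡QM ⟩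
    count M Q' + 𝟙 (Q M) + 1  ≡⟨ xy∙z≈xz∙y (count M Q') (𝟙 (Q M)) 1 ⟩
    count M Q' + 1 + 𝟙 (Q M)  ≡⟨ cong (_+ 𝟙 (Q M)) (count-remove M Q t (≤∧≢⇒< (≤-pred t<1+M) t≢M) Qt) ⟩
    count M Q + 𝟙 (Q M)       ∎
    where
    open ≡-Reasoning
    Q' : ℕ → Bool
    Q' p = Q p ∧ not (p ≡ᵇ t)
    Q'M≡QM : Q' M ≡ Q M
    Q'M≡QM = trans (cong (λ b → Q M ∧ not b) (≡ᵇ-false (t≢M ∘ sym))) (∧-identityʳ (Q M))

  count-injection : ∀ N M P Q (u : ℕ → ℕ) →
    (∀ p → p < N → P p ≡ true → u p < M × Q (u p) ≡ true) →
    (∀ p p' → p < N → p' < N → P p ≡ true → P p' ≡ true → u p ≡ u p' → p ≡ p') →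
    count N P ≤ count M Q
  count-injection zero    M P Q u maps inj = z≤n
  count-injection (suc N) M P Q u maps inj = last (P N) refl
    where
    inj' : ∀ p p' → p < N → p' < N → P p ≡ true → P p' ≡ true → u p ≡ u p' → p ≡ p'
    inj' p p' p<N p'<N = inj p p' (m<n⇒m<1+n p<N) (m<n⇒m<1+n p'<N)
    last : ∀ b → P N ≡ b → count N P + 𝟙 b ≤ count M Q
    last false _  = subst (_≤ count M Q) (sym (+-identityʳ _))
                      (count-injection N M P Q u (λ p p<N → maps p (m<n⇒m<1+n p<N)) inj')
    last true  PN = subst (count N P + 1 ≤_) (count-remove M Q (u N) (proj₁ uN) (proj₂ uN))
                      (+-monoˡ-≤ 1 (count-injection N M P (λ q → Q q ∧ not (q ≡ᵇ u N)) u maps' inj'))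
      where
      uN : u N < M × Q (u N) ≡ true
      uN = maps N ≤-refl PN
      maps' : ∀ p → p < N → P p ≡ true → u p < M × (Q (u p) ∧ not (u p ≡ᵇ u N)) ≡ true
      maps' p p<N Pp with maps p (m<n⇒m<1+n p<N) Pp
      ... | up<M , Qup rewrite Qup
          | ≡ᵇ-false (λ e → <⇒≢ p<N (inj p N (m<n⇒m<1+n p<N) ≤-refl Pp PN e)) = up<M , refl

  count-single : ∀ N P u → u < N → (∀ p → p < N → P p ≡ true → p ≡ u) → count N P ≡ 𝟙 (P u)
  count-single (suc N) P u u<1+N supp with u ≟ N
  ... | yes refl = cong (_+ 𝟙 (P u)) (count-none u P off)
    where
    off : ∀ p → p < u → P p ≡ false
    off p p<u = ¬-not (λ Pp → <⇒≢ p<u (supp p (m<n⇒m<1+n p<u) Pp))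
  ... | no u≢N rewrite count-single N P u (≤∧≢⇒< (≤-pred u<1+N) u≢N)
                         (λ p p<N → supp p (m<n⇒m<1+n p<N))
                     | ¬-not {P N} (λ PN → u≢N (sym (supp N ≤-refl PN))) = +-identityʳ _

  count-pair : ∀ N P u v → u < N → v < N → u ≢ v →
    (∀ p → p < N → P p ≡ true → p ≡ u ⊎ p ≡ v) → count N P ≡ 𝟙 (P u) + 𝟙 (P v)
  count-pair N P u v u<N v<N u≢v supp = begin
    count N P
      ≡⟨ count-split N P (_≡ᵇ u) ⟩
    count N (λ p → P p ∧ (p ≡ᵇ u)) + count N (λ p → P p ∧ not (p ≡ᵇ u))
      ≡⟨ cong₂ _+_ (count-single N _ u u<N at-u) (count-single N _ v v<N at-v) ⟩
    𝟙 (P u ∧ (u ≡ᵇ u)) + 𝟙 (P v ∧ not (v ≡ᵇ u))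
      ≡⟨ cong₂ (λ a b → 𝟙 (P u ∧ a) + 𝟙 (P v ∧ not b)) (≡ᵇ-refl u) (≡ᵇ-false (u≢v ∘ sym)) ⟩
    𝟙 (P u ∧ true) + 𝟙 (P v ∧ true)
      ≡⟨ cong₂ (λ a b → 𝟙 a + 𝟙 b) (∧-identityʳ (P u)) (∧-identityʳ (P v)) ⟩
    𝟙 (P u) + 𝟙 (P v) ∎
    where
    open ≡-Reasoning
    at-u : ∀ p → p < N → (P p ∧ (p ≡ᵇ u)) ≡ true → p ≡ u
    at-u p p<N e with P p
    ... | true = ≡ᵇ-sound e
    at-v : ∀ p → p < N → (P p ∧ not (p ≡ᵇ u)) ≡ true → p ≡ v
    at-v p p<N e with P p in Pp | p ≡ᵇ u in pu
    ... | true | false with supp p p<N Pp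
    ...   | inj₂ p≡v = p≡v
    ...   | inj₁ refl with trans (sym (≡ᵇ-refl u)) pu
    ...     | ()

  -- bounded search: the least p < N with P p (or N if there is none)
  least : ℕ → (ℕ → Bool) → ℕ
  least zero    P = 0
  least (suc N) P = if P 0 then 0 else suc (least N (P ∘ suc))

  least-minimal : ∀ N P q → q < least N P → P q ≡ false
  least-minimal (suc N) P q q<l with P 0 in P0
  least-minimal (suc N) P zero    q<l       | false = P0
  least-minimal (suc N) P (suc q) (s≤s q<l) | false = least-minimal N (P ∘ suc) q q<l

  least-found : ∀ N P p → p < N → P p ≡ true → least N P < N × P (least N P) ≡ true
  least-found (suc N) P p p<N Pp with P 0 in P0
  ... | true = s≤s z≤n , P0
  least-found (suc N) P zero    p<N       Pp | false with trans (sym P0) Pp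
  ... | ()
  least-found (suc N) P (suc p) (s≤s p<N) Pp | false =
    let (l<N , Pl) = least-found N (P ∘ suc) p p<N Pp in s≤s l<N , Pl

  -- a map of {0,…,N-1} onto itself has no collision p < q: choosing the
  -- least preimage of every point would never choose q, injecting N points
  -- into the N - 1 points other than q
  module _ (N : ℕ) (L : ℕ → ℕ) (onto : ∀ l → l < N → ∃ λ p → p < N × L p ≡ l) where

    private
      everything : ℕ → Bool
      everything _ = true

      preimage : ℕ → ℕ
      preimage l = least N (λ r → L r ≡ᵇ l)

      preimage-spec : ∀ l → l < N → preimage l < N × L (preimage l) ≡ l
      preimage-spec l l<N =
        let (r , r<N , Lr) = onto l l<N
            (s<N , Ls) = least-found N (λ r → L r ≡ᵇ l) r r<N
                           (subst (λ z → (L r ≡ᵇ z) ≡ true) Lr (≡ᵇ-refl (L r)))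
        in s<N , ≡ᵇ-sound Ls

      no-collision : ∀ p q → q < N → L p ≡ L q → p < q → ⊥
      no-collision p q q<N e p<q = <-irrefl refl
        (subst (_≤ count N everything) (+-comm (count N everything) 1)
          (subst (count N everything + 1 ≤_) (count-remove N everything q q<N refl)
            (+-monoˡ-≤ 1 (count-injection N N everything _ preimage maps inj))))
        where
        avoids-q : ∀ l → l < N → preimage l ≢ q
        avoids-q l l<N pl≡q with trans (sym (least-minimal N (λ r → L r ≡ᵇ l) p p<pl)) Lp≡l
          where
          p<pl : p < least N (λ r → L r ≡ᵇ l)
          p<pl = subst (p <_) (sym pl≡q) p<q
          Lp≡l : (L p ≡ᵇ l) ≡ true
          Lp≡l = subst (λ z → (L p ≡ᵇ z) ≡ true)
                   (trans e (trans (cong L (sym pl≡q)) (proj₂ (preimage-spec l l<N)))) (≡ᵇ-refl (L p))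
        ... | ()
        maps : ∀ l → l < N → true ≡ true → preimage l < N × (true ∧ not (preimage l ≡ᵇ q)) ≡ true
        maps l l<N _ = proj₁ (preimage-spec l l<N) , cong not (≡ᵇ-false (avoids-q l l<N))
        inj : ∀ a c → a < N → c < N → true ≡ true → true ≡ true → preimage a ≡ preimage c → a ≡ c
        inj a c a<N c<N _ _ e = trans (sym (proj₂ (preimage-spec a a<N)))
                                  (trans (cong L e) (proj₂ (preimage-spec c c<N)))

    surjective⇒injective : ∀ p q → p < N → q < N → L p ≡ L q → p ≡ q
    surjective⇒injective p q p<N q<N e with <-cmp p q
    ... | tri≈ _ p≡q _ = p≡q
    ... | tri< p<q _ _ = ⊥-elim (no-collision p q q<N e p<q)
    ... | tri> _ _ q<p = ⊥-elim (no-collision q p p<N (sym e) q<p)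

  allᵇ-intro : ∀ N f → (∀ m → m < N → f m ≡ true) → allᵇ f (upTo N) ≡ true
  allᵇ-intro N f h = along N (λ m → m) (λ m m<N → h m m<N)
    where
    along : ∀ N g → (∀ m → m < N → f (g m) ≡ true) → allᵇ f (applyUpTo g N) ≡ true
    along zero    g h = refl
    along (suc N) g h = ∧-intro (h 0 (s≤s z≤n)) (along N (g ∘ suc) (λ m m<N → h (suc m) (s≤s m<N)))

  allᵇ-elim : ∀ N f → allᵇ f (upTo N) ≡ true → ∀ m → m < N → f m ≡ true
  allᵇ-elim N f = along N (λ m → m)
    where
    along : ∀ N g → allᵇ f (applyUpTo g N) ≡ true → ∀ m → m < N → f (g m) ≡ true
    along (suc N) g e zero    _         = ∧-elimˡ e
    along (suc N) g e (suc m) (s≤s m<N) = along N (g ∘ suc) (∧-elimʳ {f (g 0)} e) m m<N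

  allᵇ-cong : ∀ {f f' : ℕ → Bool} xs → (∀ m → f m ≡ f' m) → allᵇ f xs ≡ allᵇ f' xs
  allᵇ-cong []       h = refl
  allᵇ-cong (x ∷ xs) h = cong₂ _∧_ (h x) (allᵇ-cong xs h)

  any< : ℕ → (ℕ → Bool) → Bool
  any< zero    f = false
  any< (suc N) f = any< N f ∨ f N

  any<-intro : ∀ N f m → m < N → f m ≡ true → any< N f ≡ true
  any<-intro (suc N) f m m<1+N fm with m ≟ N
  ... | yes refl = ∨-introʳ {any< m f} fm
  ... | no m≢N   = ∨-introˡ (any<-intro N f m (≤∧≢⇒< (≤-pred m<1+N) m≢N) fm)

  any<-elim : ∀ N f → any< N f ≡ true → ∃ λ m → m < N × f m ≡ true
  any<-elim (suc N) f e with any< N f in e'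
  ... | true  = let (m , m<N , fm) = any<-elim N f e' in m , m<n⇒m<1+n m<N , fm
  ... | false = N , ≤-refl , e

-- A breakpoint graph on the
-- vertices 0,…,N-1 is given by two involutions, `black` and `grey`, each
-- joining every vertex to its partner; the alternating cycles are the
-- classes of the equivalence generated by both.  We count them by their
-- least vertices, exactly as `isCycleRep` does in Defs.
module Cycles where

  open import Data.Nat
  open import Data.Nat.Properties
  open import Data.Nat.DivMod using (_%_; _/_; m≡m%n+[m/n]*n; m%n<n)
  open import Data.Bool using (Bool; true; false; _∧_; _∨_; not)
  open import Data.Bool.Properties using (∧-identityʳ; ¬-not)
  open import Data.List using (upTo)
  open import Data.Product using (_×_; _,_; proj₁; proj₂; ∃)
  open import Data.Sum using (_⊎_; inj₁; inj₂)
  open import Relation.Nullary using (¬_; yes; no)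
  open import Relation.Binary.PropositionalEquality
  open import Data.Fin using (toℕ; fromℕ<)
  open import Data.Fin.Properties using (pigeonhole; toℕ-fromℕ<; toℕ<n)
  open import Defs using (allᵇ)
  open Booleans
  open Counting

  record Involution (N : ℕ) : Set where
    field
      apply      : ℕ → ℕ
      closed     : ∀ {p} → p < N → apply p < N
      involutive : ∀ {p} → p < N → apply (apply p) ≡ p

  module AlternatingCycles {N : ℕ} (black grey : Involution N) where

    open Involution black renaming (apply to b; closed to b-closed; involutive to b-inv)
    open Involution grey  renaming (apply to g; closed to g-closed; involutive to g-inv)

    σ : ℕ → ℕ
    σ p = g (b p)

    σ^ : ℕ → ℕ → ℕ
    σ^ zero    p = p
    σ^ (suc m) p = σ (σ^ m p)

    isCycleRep : ℕ → Bool
    isCycleRep p = allᵇ (λ m → (p ≤ᵇ σ^ m p) ∧ (p ≤ᵇ b (σ^ m p))) (upTo N)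

    isLength1 : ℕ → Bool
    isLength1 p = σ p ≡ᵇ p

    cyclesWhere : (ℕ → Bool) → ℕ
    cyclesWhere Q = count N (λ p → isCycleRep p ∧ Q p)

    cycles : ℕ
    cycles = cyclesWhere (λ _ → true)

    cycles₁ : ℕ
    cycles₁ = cyclesWhere isLength1

    data _~_ : ℕ → ℕ → Set where
      ~-refl  : ∀ {p} → p ~ p
      ~-black : ∀ {p q} → p ~ q → p ~ b q
      ~-grey  : ∀ {p q} → p ~ q → p ~ g q

    ~-closed : ∀ {p q} → p < N → p ~ q → q < N
    ~-closed p<N ~-refl      = p<N
    ~-closed p<N (~-black r) = b-closed (~-closed p<N r)
    ~-closed p<N (~-grey r)  = g-closed (~-closed p<N r)

    ~-trans : ∀ {p q r} → p ~ q → q ~ r → p ~ r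
    ~-trans pq ~-refl      = pq
    ~-trans pq (~-black r) = ~-black (~-trans pq r)
    ~-trans pq (~-grey r)  = ~-grey (~-trans pq r)

    ~-sym : ∀ {p q} → p < N → p ~ q → q ~ p
    ~-sym p<N ~-refl      = ~-refl
    ~-sym p<N (~-black {q = q} r) =
      ~-trans (subst (b q ~_) (b-inv (~-closed p<N r)) (~-black ~-refl)) (~-sym p<N r)
    ~-sym p<N (~-grey {q = q} r)  =
      ~-trans (subst (g q ~_) (g-inv (~-closed p<N r)) (~-grey ~-refl)) (~-sym p<N r)

    ~σ^ : ∀ m {p} → p ~ σ^ m p
    ~σ^ zero    = ~-refl
    ~σ^ (suc m) = ~-grey (~-black (~σ^ m))

    σ^-closed : ∀ m {p} → p < N → σ^ m p < N
    σ^-closed zero    p<N = p<N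
    σ^-closed (suc m) p<N = g-closed (b-closed (σ^-closed m p<N))

    σ-injective : ∀ {p q} → p < N → q < N → σ p ≡ σ q → p ≡ q
    σ-injective {p} {q} p<N q<N e =
      trans (sym (b-inv p<N)) (trans (cong b bp≡bq) (b-inv q<N))
      where
      bp≡bq : b p ≡ b q
      bp≡bq = trans (sym (g-inv (b-closed p<N))) (trans (cong g e) (g-inv (b-closed q<N)))

    σ^-+ : ∀ a d p → σ^ (a + d) p ≡ σ^ a (σ^ d p)
    σ^-+ zero    d p = refl
    σ^-+ (suc a) d p = cong σ (σ^-+ a d p)

    σ^-injective : ∀ a {p q} → p < N → q < N → σ^ a p ≡ σ^ a q → p ≡ q
    σ^-injective zero    p<N q<N e = e
    σ^-injective (suc a) p<N q<N e =
      σ^-injective a p<N q<N (σ-injective (σ^-closed a p<N) (σ^-closed a q<N) e)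

    -- σ permutes a finite set, so every orbit is periodic with period ≤ N
    period : ∀ {p} → p < N → ∃ λ k → σ^ (suc k) p ≡ p × suc k ≤ N
    period {p} p<N with pigeonhole (n<1+n N) (λ i → fromℕ< (σ^-closed (toℕ i) p<N))
    ... | i , j , i<j , same = k , periodic , k<N
      where
      a c k : ℕ
      a = toℕ i
      c = toℕ j
      k = c ∸ suc a
      c≡a+1+k : c ≡ a + suc k
      c≡a+1+k = trans (sym (m+[n∸m]≡n {a} {c} (<⇒≤ i<j))) (cong (a +_) (+-∸-assoc 1 i<j))
      σ^a≡σ^c : σ^ a p ≡ σ^ c p
      σ^a≡σ^c = trans (sym (toℕ-fromℕ< (σ^-closed a p<N)))
                  (trans (cong toℕ same) (toℕ-fromℕ< (σ^-closed c p<N)))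
      periodic : σ^ (suc k) p ≡ p
      periodic = sym (σ^-injective a p<N (σ^-closed (suc k) p<N)
                   (trans σ^a≡σ^c (trans (cong (λ z → σ^ z p) c≡a+1+k) (σ^-+ a (suc k) p))))
      k<N : suc k ≤ N
      k<N = ≤-trans (≤-trans (m≤n+m (suc k) a) (≤-reflexive (sym c≡a+1+k))) (≤-pred (toℕ<n j))

    σ^-mod : ∀ {p} k → σ^ (suc k) p ≡ p → ∀ m → σ^ m p ≡ σ^ (m % suc k) p
    σ^-mod {p} k periodic m = begin
      σ^ m p                                         ≡⟨ cong (λ z → σ^ z p) (m≡m%n+[m/n]*n m (suc k)) ⟩
      σ^ (m % suc k + (m / suc k) * suc k) p         ≡⟨ σ^-+ (m % suc k) ((m / suc k) * suc k) p ⟩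
      σ^ (m % suc k) (σ^ ((m / suc k) * suc k) p)    ≡⟨ cong (σ^ (m % suc k)) (multiple (m / suc k)) ⟩
      σ^ (m % suc k) p                               ∎
      where
      open ≡-Reasoning
      multiple : ∀ q → σ^ (q * suc k) p ≡ p
      multiple zero    = refl
      multiple (suc q) = trans (σ^-+ (suc k) (q * suc k) p)
                           (trans (cong (σ^ (suc k)) (multiple q)) periodic)

    OnCycle : ℕ → ℕ → Set
    OnCycle p q = ∃ λ m → m < N × (q ≡ σ^ m p ⊎ q ≡ b (σ^ m p))

    ~⇒on-cycle : ∀ {p q} → p < N → p ~ q → OnCycle p q
    ~⇒on-cycle {p} p<N r with period p<N
    ... | k , periodic , k<N = reduce (walk r)
      where
      walk : ∀ {q} → p ~ q → ∃ λ m → q ≡ σ^ m p ⊎ q ≡ b (σ^ m p)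
      walk ~-refl = 0 , inj₁ refl
      walk (~-black r) with walk r
      ... | m , inj₁ e = m , inj₂ (cong b e)
      ... | m , inj₂ e = m , inj₁ (trans (cong b e) (b-inv (σ^-closed m p<N)))
      walk (~-grey r) with walk r
      ... | m     , inj₂ e = suc m , inj₁ (cong g e)
      ... | suc m , inj₁ e = m , inj₂ (trans (cong g e) (g-inv (b-closed (σ^-closed m p<N))))
      ... | zero  , inj₁ e = k , inj₂ (trans (cong g (trans e (sym periodic)))
                                         (g-inv (b-closed (σ^-closed k p<N))))
      reduce : ∀ {q} → (∃ λ m → q ≡ σ^ m p ⊎ q ≡ b (σ^ m p)) → OnCycle p q
      reduce (m , inj₁ e) = m % suc k , ≤-trans (m%n<n m (suc k)) k<N , inj₁ (trans e (σ^-mod k periodic m))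
      reduce (m , inj₂ e) = m % suc k , ≤-trans (m%n<n m (suc k)) k<N ,
                            inj₂ (trans e (cong b (σ^-mod k periodic m)))

    IsLeast : ℕ → Set
    IsLeast p = ∀ q → p ~ q → p ≤ q

    isCycleRep-sound : ∀ {p} → p < N → isCycleRep p ≡ true → IsLeast p
    isCycleRep-sound {p} p<N rep q r with ~⇒on-cycle p<N r
    ... | m , m<N , inj₁ refl = ≤ᵇ-sound (∧-elimˡ (allᵇ-elim N _ rep m m<N))
    ... | m , m<N , inj₂ refl = ≤ᵇ-sound (∧-elimʳ {p ≤ᵇ σ^ m p} (allᵇ-elim N _ rep m m<N))

    isCycleRep-complete : ∀ {p} → IsLeast p → isCycleRep p ≡ true
    isCycleRep-complete least-p = allᵇ-intro N _ (λ m _ →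
      ∧-intro (≤ᵇ-complete (least-p _ (~σ^ m))) (≤ᵇ-complete (least-p _ (~-black (~σ^ m)))))

    least-unique : ∀ {p q} → p < N → IsLeast p → IsLeast q → p ~ q → p ≡ q
    least-unique p<N least-p least-q r = ≤-antisym (least-p _ r) (least-q _ (~-sym p<N r))

    -- ~ is decidable: search the cycle description
    linked : ℕ → ℕ → Bool
    linked p q = any< N (λ m → (σ^ m p ≡ᵇ q) ∨ (b (σ^ m p) ≡ᵇ q))

    linked-sound : ∀ {p q} → linked p q ≡ true → p ~ q
    linked-sound {p} {q} e with any<-elim N _ e
    ... | m , _ , hit with σ^ m p ≡ᵇ q in e₁
    ... | true  = subst (p ~_) (≡ᵇ-sound e₁) (~σ^ m)
    ... | false = subst (p ~_) (≡ᵇ-sound hit) (~-black (~σ^ m))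

    linked-complete : ∀ {p q} → p < N → p ~ q → linked p q ≡ true
    linked-complete {p} p<N r with ~⇒on-cycle p<N r
    ... | m , m<N , inj₁ refl = any<-intro N _ m m<N (∨-introˡ (≡ᵇ-refl (σ^ m p)))
    ... | m , m<N , inj₂ refl =
      any<-intro N _ m m<N (∨-introʳ {σ^ m p ≡ᵇ b (σ^ m p)} (≡ᵇ-refl (b (σ^ m p))))

    linked-false : ∀ {p q} → p < N → linked p q ≡ false → ¬ p ~ q
    linked-false p<N e r with trans (sym e) (linked-complete p<N r)
    ... | ()

    unlinked : ∀ {p q} → ¬ p ~ q → linked p q ≡ false
    unlinked p≁q = ¬-not (λ l → p≁q (linked-sound l))

    rep : ℕ → ℕ
    rep x = least N (linked x)

    rep-spec : ∀ {x} → x < N → rep x < N × x ~ rep x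
    rep-spec {x} x<N =
      let (r<N , found) = least-found N (linked x) x x<N (linked-complete x<N ~-refl)
      in r<N , linked-sound found

    rep-least : ∀ {x} → x < N → IsLeast (rep x)
    rep-least {x} x<N q r with q <? rep x
    ... | no q≮rep = ≮⇒≥ q≮rep
    ... | yes q<rep with trans (sym (least-minimal N (linked x) q q<rep))
                          (linked-complete x<N (~-trans (proj₂ (rep-spec x<N)) r))
    ...   | ()

    rep-isCycleRep : ∀ {x} → x < N → isCycleRep (rep x) ≡ true
    rep-isCycleRep x<N = isCycleRep-complete (rep-least x<N)

    -- a cycle of length one is {p, b p}, so its length is seen from any vertex
    length1-cycle : ∀ {p q} → p < N → σ p ≡ p → p ~ q → q ≡ p ⊎ q ≡ b p
    length1-cycle p<N fixed ~-refl = inj₁ refl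
    length1-cycle p<N fixed (~-black r) with length1-cycle p<N fixed r
    ... | inj₁ refl = inj₂ refl
    ... | inj₂ refl = inj₁ (b-inv p<N)
    length1-cycle p<N fixed (~-grey r) with length1-cycle p<N fixed r
    ... | inj₁ refl = inj₂ (trans (cong g (sym fixed)) (g-inv (b-closed p<N)))
    ... | inj₂ refl = inj₁ fixed

    isLength1-~ : ∀ {p q} → p < N → p ~ q → isLength1 p ≡ true → isLength1 q ≡ true
    isLength1-~ {p} p<N r l1 with length1-cycle p<N (≡ᵇ-sound l1) r
    ... | inj₁ refl = l1
    ... | inj₂ refl = subst (λ z → (z ≡ᵇ b p) ≡ true) (sym σbp≡bp) (≡ᵇ-refl (b p))
      where
      σbp≡bp : σ (b p) ≡ b p
      σbp≡bp = trans (cong g (b-inv p<N))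
                 (trans (cong g (sym (≡ᵇ-sound l1))) (g-inv (b-closed p<N)))

    isLength1-invariant : ∀ {p q} → p < N → p ~ q → isLength1 p ≡ isLength1 q
    isLength1-invariant p<N r =
      bool-ext (isLength1-~ p<N r) (isLength1-~ (~-closed p<N r) (~-sym p<N r))

    -- the cycles through 0 or through x, counted with and without length one.
    -- 0 is the least vertex of its cycle, and the other cycle (if any) is
    -- represented by rep x.
    touches : ℕ → ℕ → Bool
    touches x p = linked p 0 ∨ linked p x

    private
      0-least : IsLeast 0
      0-least q r = z≤n

      touches-support : ∀ {x} → x < N → ∀ p → p < N → isCycleRep p ≡ true → touches x p ≡ true →
        p ≡ 0 ⊎ p ≡ rep x
      touches-support {x} x<N p p<N rep-p t with linked p 0 in l0
      ... | true  = inj₁ (n≤0⇒n≡0 (isCycleRep-sound p<N rep-p 0 (linked-sound l0)))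
      ... | false = inj₂ (least-unique p<N (isCycleRep-sound p<N rep-p) (rep-least x<N)
                           (~-trans (linked-sound t) (proj₂ (rep-spec x<N))))

      touches-0 : ∀ x → 0 < N → touches x 0 ≡ true
      touches-0 x 0<N = ∨-introˡ (linked-complete 0<N ~-refl)

      touches-rep : ∀ {x} → x < N → touches x (rep x) ≡ true
      touches-rep x<N = ∨-introʳ (linked-complete (proj₁ (rep-spec x<N)) (~-sym x<N (proj₂ (rep-spec x<N))))

      touching-support : ∀ {x} → x < N → (Q : ℕ → Bool) → ∀ p → p < N →
        ((isCycleRep p ∧ Q p) ∧ touches x p) ≡ true → p ≡ 0 ⊎ p ≡ rep x
      touching-support x<N Q p p<N e with isCycleRep p in rep-p
      ... | true = touches-support x<N p p<N rep-p (∧-elimʳ {Q p} e)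

    touching : ℕ → (ℕ → Bool) → ℕ
    touching x Q = count N (λ p → (isCycleRep p ∧ Q p) ∧ touches x p)

    untouched : ℕ → (ℕ → Bool) → ℕ
    untouched x Q = count N (λ p → (isCycleRep p ∧ Q p) ∧ not (touches x p))

    cyclesWhere-split : ∀ x Q → cyclesWhere Q ≡ touching x Q + untouched x Q
    cyclesWhere-split x Q = count-split N (λ p → isCycleRep p ∧ Q p) (touches x)

    touching-one-cycle : ∀ {x} → x < N → 0 ~ x → ∀ Q → touching x Q ≡ 𝟙 (Q 0)
    touching-one-cycle {x} x<N 0~x Q =
      trans (count-single N _ 0 0<N support)
            (cong 𝟙 (trans (cong₂ _∧_ (cong (_∧ Q 0) rep-0) (touches-0 x 0<N)) (∧-identityʳ (Q 0))))
      where
      0<N : 0 < N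
      0<N = ≤-trans (s≤s z≤n) x<N
      rep-0 : isCycleRep 0 ≡ true
      rep-0 = isCycleRep-complete 0-least
      rep-x≡0 : rep x ≡ 0
      rep-x≡0 = sym (least-unique 0<N 0-least (rep-least x<N) (~-trans 0~x (proj₂ (rep-spec x<N))))
      support : ∀ p → p < N → ((isCycleRep p ∧ Q p) ∧ touches x p) ≡ true → p ≡ 0
      support p p<N e with touching-support x<N Q p p<N e
      ... | inj₁ p≡0 = p≡0
      ... | inj₂ p≡r = trans p≡r rep-x≡0

    touching-two-cycles : ∀ {x} → x < N → ¬ 0 ~ x → ∀ Q →
      (∀ {p q} → p < N → p ~ q → Q p ≡ Q q) → touching x Q ≡ 𝟙 (Q 0) + 𝟙 (Q x)
    touching-two-cycles {x} x<N 0≁x Q Q-inv =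
      trans (count-pair N _ 0 (rep x) 0<N r<N 0≢r (touching-support x<N Q))
            (cong₂ (λ u v → 𝟙 u + 𝟙 v)
              (trans (cong₂ _∧_ (cong (_∧ Q 0) (isCycleRep-complete 0-least)) (touches-0 x 0<N))
                     (∧-identityʳ (Q 0)))
              (trans (cong₂ _∧_ (cong₂ _∧_ (rep-isCycleRep x<N) (sym (Q-inv x<N x~r))) (touches-rep x<N))
                     (∧-identityʳ (Q x))))
      where
      0<N : 0 < N
      0<N = ≤-trans (s≤s z≤n) x<N
      r<N : rep x < N
      r<N = proj₁ (rep-spec x<N)
      x~r : x ~ rep x
      x~r = proj₂ (rep-spec x<N)
      0≢r : 0 ≢ rep x
      0≢r e = 0≁x (~-sym x<N (subst (x ~_) (sym e) x~r))

module Relabelling where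

  open import Data.Nat
  open import Data.Nat.Properties using (≤-antisym)
  open import Data.Bool using (Bool; true; _∧_)
  open import Data.Product using (_×_; _,_; proj₂)
  open import Relation.Binary.PropositionalEquality
  open Booleans
  open Counting
  open Cycles

  Conjugate : ∀ {N} → Involution N → Involution N → Involution N → Set
  Conjugate {N} f h₁ h₂ = ∀ {p} → p < N → apply h₂ p ≡ apply f (apply h₁ (apply f p))
    where open Involution

  module Relabelled {N : ℕ} (black₁ grey₁ black₂ grey₂ f : Involution N)
    (black-conj : Conjugate f black₁ black₂) (grey-conj : Conjugate f grey₁ grey₂) where

    module G₁ = AlternatingCycles black₁ grey₁
    module G₂ = AlternatingCycles black₂ grey₂
    open Involution black₁ renaming (apply to b₁; closed to b₁-closed)
    open Involution grey₁  renaming (apply to g₁)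
    open Involution black₂ renaming (apply to b₂; closed to b₂-closed)
    open Involution f      renaming (apply to φ; closed to φ-closed; involutive to φ-inv)

    ~-relabel : ∀ {x y} → x < N → x G₁.~ y → φ x G₂.~ φ y
    ~-relabel x<N G₁.~-refl = G₂.~-refl
    ~-relabel x<N (G₁.~-black {q = q} r) =
      subst (_ G₂.~_) (trans (black-conj (φ-closed q<N)) (cong (λ z → φ (b₁ z)) (φ-inv q<N)))
            (G₂.~-black (~-relabel x<N r))
      where
      q<N : q < N
      q<N = G₁.~-closed x<N r
    ~-relabel x<N (G₁.~-grey {q = q} r) =
      subst (_ G₂.~_) (trans (grey-conj (φ-closed q<N)) (cong (λ z → φ (g₁ z)) (φ-inv q<N)))
            (G₂.~-grey (~-relabel x<N r))
      where
      q<N : q < N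
      q<N = G₁.~-closed x<N r

    σ-relabel : ∀ {p} → p < N → G₂.σ p ≡ φ (G₁.σ (φ p))
    σ-relabel {p} p<N = begin
      G₂.σ p                    ≡⟨ grey-conj (b₂-closed p<N) ⟩
      φ (g₁ (φ (b₂ p)))         ≡⟨ cong (λ z → φ (g₁ (φ z))) (black-conj p<N) ⟩
      φ (g₁ (φ (φ (b₁ (φ p))))) ≡⟨ cong (λ z → φ (g₁ z)) (φ-inv (b₁-closed (φ-closed p<N))) ⟩
      φ (G₁.σ (φ p))            ∎
      where open ≡-Reasoning

    isLength1-relabel : ∀ {p} → p < N → G₂.isLength1 p ≡ G₁.isLength1 (φ p)
    isLength1-relabel {p} p<N = bool-ext to from
      where
      to : G₂.isLength1 p ≡ true → G₁.isLength1 (φ p) ≡ true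
      to l1 = subst (λ z → (G₁.σ (φ p) ≡ᵇ z) ≡ true)
                (trans (sym (φ-inv (G₁.σ^-closed 1 (φ-closed p<N))))
                       (cong φ (trans (sym (σ-relabel p<N)) (≡ᵇ-sound l1))))
                (≡ᵇ-refl (G₁.σ (φ p)))
      from : G₁.isLength1 (φ p) ≡ true → G₂.isLength1 p ≡ true
      from l1 = subst (λ z → (G₂.σ p ≡ᵇ z) ≡ true)
                  (trans (σ-relabel p<N) (trans (cong φ (≡ᵇ-sound l1)) (φ-inv p<N)))
                  (≡ᵇ-refl (G₂.σ p))

    -- p ↦ least vertex of the cycle of f p injects the cycles of graph 2
    -- into those of graph 1
    cyclesWhere-≤ : ∀ (Q₁ Q₂ : ℕ → Bool) →
      (∀ p → p < N → Q₂ p ≡ true → Q₁ (φ p) ≡ true) →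
      (∀ {p q} → p < N → p G₁.~ q → Q₁ p ≡ Q₁ q) →
      G₂.cyclesWhere Q₂ ≤ G₁.cyclesWhere Q₁
    cyclesWhere-≤ Q₁ Q₂ Q₂⇒Q₁ Q₁-inv = count-injection N N _ _ (λ p → G₁.rep (φ p)) maps inj
      where
      maps : ∀ p → p < N → (G₂.isCycleRep p ∧ Q₂ p) ≡ true →
        G₁.rep (φ p) < N × (G₁.isCycleRep (G₁.rep (φ p)) ∧ Q₁ (G₁.rep (φ p))) ≡ true
      maps p p<N e with G₁.rep-spec (φ-closed p<N)
      ... | r<N , φp~r = r<N , ∧-intro (G₁.rep-isCycleRep (φ-closed p<N))
        (trans (sym (Q₁-inv (φ-closed p<N) φp~r)) (Q₂⇒Q₁ p p<N (∧-elimʳ {G₂.isCycleRep p} e)))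
      inj : ∀ p p' → p < N → p' < N → (G₂.isCycleRep p ∧ Q₂ p) ≡ true → (G₂.isCycleRep p' ∧ Q₂ p') ≡ true →
        G₁.rep (φ p) ≡ G₁.rep (φ p') → p ≡ p'
      inj p p' p<N p'<N e e' same =
        G₂.least-unique p<N (G₂.isCycleRep-sound p<N (∧-elimˡ e)) (G₂.isCycleRep-sound p'<N (∧-elimˡ e'))
          (subst₂ G₂._~_ (φ-inv p<N) (φ-inv p'<N) (~-relabel (φ-closed p<N) φp~φp'))
        where
        φp~φp' : φ p G₁.~ φ p'
        φp~φp' = G₁.~-trans (proj₂ (G₁.rep-spec (φ-closed p<N)))
                   (subst (G₁._~ φ p') (sym same)
                     (G₁.~-sym (φ-closed p'<N) (proj₂ (G₁.rep-spec (φ-closed p'<N)))))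

  -- the relabelling is symmetric, so the counts are equal
  module Isomorphic {N : ℕ} (black₁ grey₁ black₂ grey₂ f : Involution N)
    (black-conj : Conjugate f black₁ black₂) (grey-conj : Conjugate f grey₁ grey₂) where

    open Relabelled black₁ grey₁ black₂ grey₂ f black-conj grey-conj public
    open Involution f renaming (apply to φ; closed to φ-closed; involutive to φ-inv)

    private
      conj-inverse : ∀ (h₁ h₂ : Involution N) → Conjugate f h₁ h₂ → Conjugate f h₂ h₁
      conj-inverse h₁ h₂ conj {p} p<N = sym (begin
        φ (apply h₂ (φ p))          ≡⟨ cong φ (conj (φ-closed p<N)) ⟩
        φ (φ (apply h₁ (φ (φ p))))  ≡⟨ φ-inv (Involution.closed h₁ (φ-closed (φ-closed p<N))) ⟩
        apply h₁ (φ (φ p))          ≡⟨ cong (apply h₁) (φ-inv p<N) ⟩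
        apply h₁ p                  ∎)
        where
        open ≡-Reasoning
        open Involution using (apply)

    module Backward = Relabelled black₂ grey₂ black₁ grey₁ f
      (conj-inverse black₁ black₂ black-conj) (conj-inverse grey₁ grey₂ grey-conj)

    cycles-≡ : G₂.cycles ≡ G₁.cycles
    cycles-≡ = ≤-antisym
      (cyclesWhere-≤ _ _ (λ _ _ _ → refl) (λ _ _ → refl))
      (Backward.cyclesWhere-≤ _ _ (λ _ _ _ → refl) (λ _ _ → refl))

    cycles₁-≡ : G₂.cycles₁ ≡ G₁.cycles₁
    cycles₁-≡ = ≤-antisym
      (cyclesWhere-≤ G₁.isLength1 G₂.isLength1
        (λ p p<N l1 → trans (sym (isLength1-relabel p<N)) l1) G₁.isLength1-invariant)
      (Backward.cyclesWhere-≤ G₂.isLength1 G₁.isLength1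
        (λ p p<N l1 → trans (isLength1-relabel (φ-closed p<N)) (trans (cong G₁.isLength1 (φ-inv p<N)) l1))
        G₂.isLength1-invariant)

-- Only the (at most two)
-- cycles through 0 and x change, which bounds how c - 2c₁ and the length of
-- the cycle through 0 can change.
module BlackSwap where

  open import Data.Nat
  open import Data.Nat.Properties
  open import Data.Bool using (Bool; true; false; _∧_; _∨_; not)
  open import Data.Bool.Properties using (∨-conicalˡ; ∨-conicalʳ; ¬-not)
  open import Data.Product using (_×_; _,_; proj₁; proj₂)
  open import Relation.Nullary using (¬_)
  open import Relation.Binary.PropositionalEquality
  open import Data.Nat.Tactic.RingSolver using (solve-∀)
  open Booleans
  open Counting
  open Cycles

  module SharedGrey {N : ℕ} (black black' grey : Involution N) where

    module G  = AlternatingCycles black grey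
    module G' = AlternatingCycles black' grey
    open Involution black  renaming (apply to b)
    open Involution black' renaming (apply to b')

    module _ {p : ℕ} (agree : ∀ q → p G.~ q → b q ≡ b' q) where

      ~-forward : ∀ {q} → p G.~ q → p G'.~ q
      ~-forward G.~-refl      = G'.~-refl
      ~-forward (G.~-black r) = subst (p G'.~_) (sym (agree _ r)) (G'.~-black (~-forward r))
      ~-forward (G.~-grey r)  = G'.~-grey (~-forward r)

      ~-backward : ∀ {q} → p G'.~ q → p G.~ q
      ~-backward G'.~-refl      = G.~-refl
      ~-backward (G'.~-black r) = subst (p G.~_) (agree _ (~-backward r)) (G.~-black (~-backward r))
      ~-backward (G'.~-grey r)  = G.~-grey (~-backward r)

  module Swap {N : ℕ} (black black' grey : Involution N)
    (x : ℕ) (x+1<N : suc x < N) (1<x : 1 < x)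
    (b-0 : Involution.apply black 0 ≡ 1) (b-x : Involution.apply black x ≡ suc x)
    (b'-0 : Involution.apply black' 0 ≡ x) (b'-1 : Involution.apply black' 1 ≡ suc x)
    (b-elsewhere : ∀ q → q < N → q ≢ 0 → q ≢ 1 → q ≢ x → q ≢ suc x →
                   Involution.apply black q ≡ Involution.apply black' q)
    where

    module S = AlternatingCycles black grey
    module M = AlternatingCycles black' grey
    module S→M = SharedGrey black black' grey
    module M→S = SharedGrey black' black grey
    open Involution black  renaming (apply to b;  involutive to b-inv)
    open Involution black' renaming (apply to b'; involutive to b'-inv)
    open Involution grey   renaming (apply to g;  involutive to g-inv)

    x<N : x < N
    x<N = <-trans (n<1+n x) x+1<N
    0<N : 0 < N
    0<N = ≤-trans (s≤s z≤n) x<N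
    1<N : 1 < N
    1<N = <-trans 1<x x<N

    b-1 : b 1 ≡ 0
    b-1 = trans (cong b (sym b-0)) (b-inv 0<N)
    b-x+1 : b (suc x) ≡ x
    b-x+1 = trans (cong b (sym b-x)) (b-inv x<N)
    b'-x : b' x ≡ 0
    b'-x = trans (cong b' (sym b'-0)) (b'-inv 0<N)
    b'-x+1 : b' (suc x) ≡ 1
    b'-x+1 = trans (cong b' (sym b'-1)) (b'-inv 1<N)

    S-agree : ∀ {p} → p < N → ¬ p S.~ 0 → ¬ p S.~ x → ∀ q → p S.~ q → b q ≡ b' q
    S-agree {p} p<N p≁0 p≁x q r = b-elsewhere q (S.~-closed p<N r) q≢0 q≢1 q≢x q≢x+1
      where
      q≢0 : q ≢ 0
      q≢0 refl = p≁0 r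
      q≢1 : q ≢ 1
      q≢1 refl = p≁0 (subst (p S.~_) b-1 (S.~-black r))
      q≢x : q ≢ x
      q≢x refl = p≁x r
      q≢x+1 : q ≢ suc x
      q≢x+1 refl = p≁x (subst (p S.~_) b-x+1 (S.~-black r))

    M-agree : ∀ {p} → p < N → ¬ p M.~ 0 → ¬ p M.~ 1 → ∀ q → p M.~ q → b' q ≡ b q
    M-agree {p} p<N p≁0 p≁1 q r = sym (b-elsewhere q (M.~-closed p<N r) q≢0 q≢1 q≢x q≢x+1)
      where
      q≢0 : q ≢ 0
      q≢0 refl = p≁0 r
      q≢1 : q ≢ 1
      q≢1 refl = p≁1 r
      q≢x : q ≢ x
      q≢x refl = p≁0 (subst (p M.~_) b'-x (M.~-black r))
      q≢x+1 : q ≢ suc x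
      q≢x+1 refl = p≁1 (subst (p M.~_) b'-x+1 (M.~-black r))

    -- the changed cycles are those through {0, x} in S and through {0, 1} in M
    touches-same : ∀ {p} → p < N → S.touches x p ≡ M.touches 1 p
    touches-same {p} p<N = bool-ext-false S-side M-side
      where
      S-side : S.touches x p ≡ false → M.touches 1 p ≡ false
      S-side e = cong₂ _∨_ (M.unlinked λ r → p≁0 (back r))
                           (M.unlinked λ r → p≁0 (subst (p S.~_) b-1 (S.~-black (back r))))
        where
        p≁0 : ¬ p S.~ 0
        p≁0 = S.linked-false p<N (∨-conicalˡ _ _ e)
        p≁x : ¬ p S.~ x
        p≁x = S.linked-false p<N (∨-conicalʳ _ _ e)
        back : ∀ {q} → p M.~ q → p S.~ q
        back = S→M.~-backward (S-agree p<N p≁0 p≁x)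
      M-side : M.touches 1 p ≡ false → S.touches x p ≡ false
      M-side e = cong₂ _∨_ (S.unlinked λ r → p≁0 (back r))
                           (S.unlinked λ r → p≁0 (subst (p M.~_) b'-x (M.~-black (back r))))
        where
        p≁0 : ¬ p M.~ 0
        p≁0 = M.linked-false p<N (∨-conicalˡ _ _ e)
        p≁1 : ¬ p M.~ 1
        p≁1 = M.linked-false p<N (∨-conicalʳ _ _ e)
        back : ∀ {q} → p S.~ q → p M.~ q
        back = M→S.~-backward (M-agree p<N p≁0 p≁1)

    unchanged : ∀ {p} → p < N → S.touches x p ≡ false →
      S.isCycleRep p ≡ M.isCycleRep p × S.isLength1 p ≡ M.isLength1 p
    unchanged {p} p<N e =
      bool-ext (λ t → M.isCycleRep-complete (λ q r → S.isCycleRep-sound p<N t q (S→M.~-backward agree r)))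
               (λ t → S.isCycleRep-complete (λ q r → M.isCycleRep-sound p<N t q (S→M.~-forward agree r))) ,
      cong (λ z → g z ≡ᵇ p) (agree p S.~-refl)
      where
      agree : ∀ q → p S.~ q → b q ≡ b' q
      agree = S-agree p<N (S.linked-false p<N (∨-conicalˡ _ _ e)) (S.linked-false p<N (∨-conicalʳ _ _ e))

    untouched-≡ : ∀ (Q Q' : ℕ → Bool) → (∀ {p} → p < N → S.touches x p ≡ false → Q p ≡ Q' p) →
      S.untouched x Q ≡ M.untouched 1 Q'
    untouched-≡ Q Q' Q≡Q' = count-ext N _ _ pointwise
      where
      pointwise : ∀ p → p < N →
        ((S.isCycleRep p ∧ Q p) ∧ not (S.touches x p)) ≡ ((M.isCycleRep p ∧ Q' p) ∧ not (M.touches 1 p))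
      pointwise p p<N = ∧-not-cong (touches-same p<N)
        (λ e → cong₂ _∧_ (proj₁ (unchanged p<N e)) (Q≡Q' p<N e))

    M-length1-at-1 : M.isLength1 1 ≡ true → 0 S.~ x
    M-length1-at-1 l1 =
      subst (0 S.~_) b-x+1 (S.~-black (subst (0 S.~_) g-1 (S.~-grey (subst (0 S.~_) b-0 (S.~-black S.~-refl)))))
      where
      g-1 : g 1 ≡ suc x
      g-1 = trans (cong g (sym (trans (sym (cong g b'-1)) (≡ᵇ-sound l1)))) (g-inv x+1<N)

    private
      every : ℕ → Bool
      every _ = true

      zS zM : ℕ
      zS = 𝟙 (S.isLength1 0)
      zM = 𝟙 (M.isLength1 0)

      𝟙≤1 : ∀ l → 𝟙 l ≤ 1
      𝟙≤1 false = z≤n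
      𝟙≤1 true  = ≤-refl

      swap-arith : ∀ kS kM eS eM U U₁ → kS + 2 * eM ≤ kM + 2 * eS + 1 →
        (kS + U) + 2 * ((zM + eM) + U₁) + 2 * zS ≤ (kM + U) + 2 * ((zS + eS) + U₁) + 2 * zM + 1
      swap-arith kS kM eS eM U U₁ local =
        subst₂ _≤_ (lhs kS eM U U₁ zS zM) (rhs kM eS U U₁ zS zM)
                   (+-monoˡ-≤ (U + 2 * U₁ + 2 * zS + 2 * zM) local)
        where
        lhs : ∀ kS eM U U₁ zS zM →
          kS + 2 * eM + (U + 2 * U₁ + 2 * zS + 2 * zM) ≡ (kS + U) + 2 * ((zM + eM) + U₁) + 2 * zS
        lhs = solve-∀
        rhs : ∀ kM eS U U₁ zS zM →
          kM + 2 * eS + 1 + (U + 2 * U₁ + 2 * zS + 2 * zM) ≡ (kM + U) + 2 * ((zS + eS) + U₁) + 2 * zM + 1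
        rhs = solve-∀

      -- splitting the four counts into changed and unchanged cycles: the
      -- unchanged ones agree in S and M, so only the changed ones matter
      combine : ∀ kS kM eS eM →
        S.touching x every ≡ kS → M.touching 1 every ≡ kM →
        S.touching x S.isLength1 ≡ zS + eS → M.touching 1 M.isLength1 ≡ zM + eM →
        kS + 2 * eM ≤ kM + 2 * eS + 1 →
        S.cycles + 2 * M.cycles₁ + 2 * zS ≤ M.cycles + 2 * S.cycles₁ + 2 * zM + 1
      combine kS kM eS eM kS≡ kM≡ AS≡ AM≡ local = begin
        S.cycles + 2 * M.cycles₁ + 2 * zS
          ≡⟨ cong₂ (λ c c₁ → c + 2 * c₁ + 2 * zS)
                   (trans (S.cyclesWhere-split x every) (cong (_+ U) kS≡))
                   (trans (M.cyclesWhere-split 1 M.isLength1) (cong₂ _+_ AM≡ (sym U₁≡))) ⟩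
        (kS + U) + 2 * ((zM + eM) + U₁) + 2 * zS
          ≤⟨ swap-arith kS kM eS eM U U₁ local ⟩
        (kM + U) + 2 * ((zS + eS) + U₁) + 2 * zM + 1
          ≡⟨ cong₂ (λ c c₁ → c + 2 * c₁ + 2 * zM + 1)
                   (sym (trans (M.cyclesWhere-split 1 every) (cong₂ _+_ kM≡ (sym U≡))))
                   (sym (trans (S.cyclesWhere-split x S.isLength1) (cong (_+ U₁) AS≡))) ⟩
        M.cycles + 2 * S.cycles₁ + 2 * zM + 1 ∎
        where
        open ≤-Reasoning
        U U₁ : ℕ
        U  = S.untouched x every
        U₁ = S.untouched x S.isLength1
        U≡ : U ≡ M.untouched 1 every
        U≡ = untouched-≡ every every (λ _ _ → refl)
        U₁≡ : U₁ ≡ M.untouched 1 M.isLength1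
        U₁≡ = untouched-≡ S.isLength1 M.isLength1 (λ p<N e → proj₂ (unchanged p<N e))

    -- Exchanging the black edges {0,1},{x,x+1} for {0,x},{1,x+1}: with
    -- Φ = c - 2c₁ + 2·[the cycle through 0 has length one], Φ(S) ≤ Φ(M) + 1.
    -- The four cases say whether 0 ~ x in S and whether 0 ~ 1 in M.
    swap-inequality : S.cycles + 2 * M.cycles₁ + 2 * 𝟙 (S.isLength1 0)
                        ≤ M.cycles + 2 * S.cycles₁ + 2 * 𝟙 (M.isLength1 0) + 1
    swap-inequality = by-cases (S.linked 0 x) (M.linked 0 1) refl refl
      where
      by-cases : ∀ s m → S.linked 0 x ≡ s → M.linked 0 1 ≡ m →
        S.cycles + 2 * M.cycles₁ + 2 * zS ≤ M.cycles + 2 * S.cycles₁ + 2 * zM + 1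
      by-cases true true eS eM = combine 1 1 0 0
        (S.touching-one-cycle x<N 0~x every) (M.touching-one-cycle 1<N 0~1 every)
        (trans (S.touching-one-cycle x<N 0~x S.isLength1) (sym (+-identityʳ zS)))
        (trans (M.touching-one-cycle 1<N 0~1 M.isLength1) (sym (+-identityʳ zM)))
        (n≤1+n 1)
        where
        0~x : 0 S.~ x
        0~x = S.linked-sound eS
        0~1 : 0 M.~ 1
        0~1 = M.linked-sound eM
      by-cases true false eS eM = combine 1 2 0 (𝟙 (M.isLength1 1))
        (S.touching-one-cycle x<N 0~x every) (M.touching-two-cycles 1<N 0≁1 every λ _ _ → refl)
        (trans (S.touching-one-cycle x<N 0~x S.isLength1) (sym (+-identityʳ zS)))
        (M.touching-two-cycles 1<N 0≁1 M.isLength1 M.isLength1-invariant)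
        (+-monoʳ-≤ 1 (*-monoʳ-≤ 2 (𝟙≤1 (M.isLength1 1))))
        where
        0~x : 0 S.~ x
        0~x = S.linked-sound eS
        0≁1 : ¬ 0 M.~ 1
        0≁1 = M.linked-false 0<N eM
      by-cases false true eS eM = combine 2 1 (𝟙 (S.isLength1 x)) 0
        (S.touching-two-cycles x<N 0≁x every λ _ _ → refl) (M.touching-one-cycle 1<N 0~1 every)
        (S.touching-two-cycles x<N 0≁x S.isLength1 S.isLength1-invariant)
        (trans (M.touching-one-cycle 1<N 0~1 M.isLength1) (sym (+-identityʳ zM)))
        (≤-trans (m≤m+n 2 (2 * lS)) (≤-reflexive (+-comm 1 (1 + 2 * lS))))
        where
        0≁x : ¬ 0 S.~ x
        0≁x = S.linked-false 0<N eS
        0~1 : 0 M.~ 1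
        0~1 = M.linked-sound eM
        lS : ℕ
        lS = 𝟙 (S.isLength1 x)
      by-cases false false eS eM = combine 2 2 (𝟙 (S.isLength1 x)) (𝟙 (M.isLength1 1))
        (S.touching-two-cycles x<N 0≁x every λ _ _ → refl)
        (M.touching-two-cycles 1<N 0≁1 every λ _ _ → refl)
        (S.touching-two-cycles x<N 0≁x S.isLength1 S.isLength1-invariant)
        (M.touching-two-cycles 1<N 0≁1 M.isLength1 M.isLength1-invariant)
        (subst (λ l → 2 + 2 * 𝟙 l ≤ 2 + 2 * lS + 1) (sym M-1-long)
          (≤-trans (m≤m+n 2 (2 * lS + 1)) (≤-reflexive (sym (+-assoc 2 (2 * lS) 1)))))
        where
        0≁x : ¬ 0 S.~ x
        0≁x = S.linked-false 0<N eS
        0≁1 : ¬ 0 M.~ 1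
        0≁1 = M.linked-false 0<N eM
        lS : ℕ
        lS = 𝟙 (S.isLength1 x)
        -- otherwise 0 and x would share a cycle of S
        M-1-long : M.isLength1 1 ≡ false
        M-1-long = ¬-not (λ l1 → 0≁x (M-length1-at-1 l1))

-- The sequence π' of Defs as a list of labels, the positions of its
-- entries, and the effect of a prefix reversal: ρ̄(1,j) reverses the
-- positions 1,…,2j of π' and swaps the two labels of every reversed entry,
-- so that the new π' is the old one read through the position involution
-- `revPos j`.
module Labels where

  open import Data.Nat
  open import Data.Nat.Properties
  open import Data.Integer as ℤ using (ℤ; -[1+_]; -_)
  open import Data.Bool using (true; false; T; if_then_else_)
  open import Data.List using (List; []; _∷_; _++_; length; map; reverse; take; drop; concatMap)
  open import Data.List.Properties
    using (length-++; reverse-++; unfold-reverse; length-reverse; take++drop≡id; length-take; length-drop;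
           concatMap-++; map-++; ++-assoc; length-map; ++-identityʳ)
  open import Data.Product using (_×_; _,_; ∃)
  open import Data.Sum using (_⊎_; inj₁; inj₂)
  open import Data.Empty using (⊥-elim)
  open import Relation.Nullary using (yes; no)
  open import Relation.Binary.PropositionalEquality
  open import Defs
  open Booleans

  entry : ℤ → List ℕ
  entry (ℤ.+ k)      = (2 * k ∸ 1) ∷ (2 * k) ∷ []
  entry -[1+ k ] = (2 * suc k) ∷ (2 * suc k ∸ 1) ∷ []

  entries : List ℤ → List ℕ
  entries = concatMap entry

  extend-≡ : ∀ n π → extend n π ≡ 0 ∷ entries π ++ (suc (2 * n) ∷ [])
  extend-≡ n π = cong (λ z → 0 ∷ z ++ (suc (2 * n) ∷ []))
                       (along _ (λ { (ℤ.+ k) → refl ; -[1+ k ] → refl }) π)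
    where
    along : (h : ℤ → List ℕ) → (∀ x → h x ≡ entry x) → ∀ ys → concatMap h ys ≡ entries ys
    along h h≡ []       = refl
    along h h≡ (y ∷ ys) = cong₂ _++_ (h≡ y) (along h h≡ ys)

  length-entries : ∀ π → length (entries π) ≡ 2 * length π
  length-entries []            = refl
  length-entries (ℤ.+ k ∷ π)    = trans (cong (λ z → suc (suc z)) (length-entries π)) (sym (*-suc 2 (length π)))
  length-entries (-[1+ k ] ∷ π) = trans (cong (λ z → suc (suc z)) (length-entries π)) (sym (*-suc 2 (length π)))

  entries-++ : ∀ xs ys → entries (xs ++ ys) ≡ entries xs ++ entries ys
  entries-++ = concatMap-++ entry

  entry-neg : ∀ x → entry (- x) ≡ reverse (entry x)
  entry-neg (ℤ.+ zero)  = refl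
  entry-neg (ℤ.+ suc k) = refl
  entry-neg -[1+ k ]  = refl

  entries-neg-reverse : ∀ xs → entries (map -_ (reverse xs)) ≡ reverse (entries xs)
  entries-neg-reverse []       = refl
  entries-neg-reverse (x ∷ xs) = begin
    entries (map -_ (reverse (x ∷ xs)))           ≡⟨ cong (λ z → entries (map -_ z)) (unfold-reverse x xs) ⟩
    entries (map -_ (reverse xs ++ x ∷ []))       ≡⟨ cong entries (map-++ -_ (reverse xs) (x ∷ [])) ⟩
    entries (map -_ (reverse xs) ++ (- x) ∷ [])   ≡⟨ entries-++ (map -_ (reverse xs)) ((- x) ∷ []) ⟩
    entries (map -_ (reverse xs)) ++ entries ((- x) ∷ [])
      ≡⟨ cong₂ _++_ (entries-neg-reverse xs) (trans (++-identityʳ (entry (- x))) (entry-neg x)) ⟩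
    reverse (entries xs) ++ reverse (entry x)     ≡⟨ sym (reverse-++ (entry x) (entries xs)) ⟩
    reverse (entries (x ∷ xs))                    ∎
    where open ≡-Reasoning

  at-++ˡ : ∀ xs ys q → q < length xs → at (xs ++ ys) q ≡ at xs q
  at-++ˡ (x ∷ xs) ys zero    _         = refl
  at-++ˡ (x ∷ xs) ys (suc q) (s≤s q<l) = at-++ˡ xs ys q q<l

  at-++ʳ : ∀ xs ys r → at (xs ++ ys) (length xs + r) ≡ at ys r
  at-++ʳ []       ys r = refl
  at-++ʳ (x ∷ xs) ys r = at-++ʳ xs ys r

  at-reverse : ∀ xs q → q < length xs → at (reverse xs) q ≡ at xs (length xs ∸ suc q)
  at-reverse (x ∷ xs) q q<l rewrite unfold-reverse x xs with q <? length xs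
  ... | yes q<l' = trans (at-++ˡ (reverse xs) (x ∷ []) q (subst (q <_) (sym (length-reverse xs)) q<l'))
                     (trans (at-reverse xs q q<l') (cong (at (x ∷ xs)) (sym (+-∸-assoc 1 q<l'))))
  ... | no q≮l' with ≤-antisym (≤-pred q<l) (≮⇒≥ q≮l')
  ... | refl = trans (subst (λ z → at (reverse xs ++ x ∷ []) z ≡ x)
                            (trans (+-identityʳ _) (length-reverse xs)) (at-++ʳ (reverse xs) (x ∷ []) 0))
                     (cong (at (x ∷ xs)) (sym (n∸n≡0 (length xs))))

  indexOf-first : ∀ xs l q → q < length xs → at xs q ≡ l → indexOf l xs ≤ q × at xs (indexOf l xs) ≡ l
  indexOf-first (x ∷ xs) l q q<l e with x ≡ᵇ l in x≡l
  ... | true = z≤n , ≡ᵇ-sound x≡l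
  indexOf-first (x ∷ xs) l zero    q<l e | false rewrite e with trans (sym (≡ᵇ-refl l)) x≡l
  ... | ()
  indexOf-first (x ∷ xs) l (suc q) (s≤s q<l) e | false =
    let (i≤q , found) = indexOf-first xs l q q<l e in s≤s i≤q , found

  pairFlip-involutive : ∀ x → pairFlip (pairFlip x) ≡ x
  pairFlip-involutive zero          = refl
  pairFlip-involutive (suc zero)    = refl
  pairFlip-involutive (suc (suc x)) = cong (λ z → suc (suc z)) (pairFlip-involutive x)

  2*-≡-+ : ∀ k → 2 * k ≡ k + k
  2*-≡-+ k = cong (k +_) (+-identityʳ k)

  pairFlip-even : ∀ k → pairFlip (2 * k) ≡ suc (2 * k)
  pairFlip-even k rewrite 2*-≡-+ k = double k
    where
    double : ∀ k → pairFlip (k + k) ≡ suc (k + k)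
    double zero    = refl
    double (suc k) rewrite +-suc k k = cong (λ z → suc (suc z)) (double k)

  pairFlip-odd : ∀ k → pairFlip (suc (2 * k)) ≡ 2 * k
  pairFlip-odd k rewrite 2*-≡-+ k = double k
    where
    double : ∀ k → pairFlip (suc (k + k)) ≡ k + k
    double zero    = refl
    double (suc k) rewrite +-suc k k = cong (λ z → suc (suc z)) (double k)

  even-or-odd : ∀ q → ∃ λ i → q ≡ 2 * i ⊎ q ≡ suc (2 * i)
  even-or-odd zero    = 0 , inj₁ refl
  even-or-odd (suc q) with even-or-odd q
  ... | i , inj₁ e = i , inj₂ (cong suc e)
  ... | i , inj₂ e = suc i , inj₁ (trans (cong suc e) (sym (*-suc 2 i)))

  pairFlip-< : ∀ n {x} → x < 2 + 2 * n → pairFlip x < 2 + 2 * n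
  pairFlip-< n {x} x<N with even-or-odd x
  ... | i , inj₂ refl rewrite pairFlip-odd i = ≤-trans (n≤1+n _) x<N
  ... | i , inj₁ refl rewrite pairFlip-even i with i ≤? n
  ...   | yes i≤n = s≤s (s≤s (*-monoʳ-≤ 2 i≤n))
  ...   | no  i≰n = ⊥-elim (<⇒≱ x<N (≤-trans (≤-reflexive (sym (*-suc 2 n))) (*-monoʳ-≤ 2 (≰⇒> i≰n))))

  revPos : ℕ → ℕ → ℕ
  revPos j zero    = zero
  revPos j (suc q) = if q <ᵇ 2 * j then 2 * j ∸ q else suc q

  revPos-inside : ∀ j q t → suc (q + t) ≡ 2 * j → revPos j (suc q) ≡ suc t
  revPos-inside j q t e rewrite T⇒≡ (<⇒<ᵇ (subst (q <_) e (s≤s (m≤m+n q t)))) =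
    trans (cong (_∸ q) (sym e)) (trans (cong (_∸ q) (sym (+-suc q t))) (m+n∸m≡n q (suc t)))

  revPos-outside : ∀ j q → 2 * j ≤ q → revPos j (suc q) ≡ suc q
  revPos-outside j q 2j≤q with q <ᵇ 2 * j in e
  ... | false = refl
  ... | true  = ⊥-elim (<⇒≱ (<ᵇ⇒< q (2 * j) (≡⇒T e)) 2j≤q)
    where
    ≡⇒T : ∀ {x} → x ≡ true → T x
    ≡⇒T refl = _

  revPos-cases : ∀ j q → (∃ λ t → suc (q + t) ≡ 2 * j) ⊎ 2 * j ≤ q
  revPos-cases j q with q <? 2 * j
  ... | yes q<2j = inj₁ (2 * j ∸ suc q , m+[n∸m]≡n q<2j)
  ... | no  q≮2j = inj₂ (≮⇒≥ q≮2j)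

  revPos-involutive : ∀ j q → revPos j (revPos j q) ≡ q
  revPos-involutive j zero    = refl
  revPos-involutive j (suc q) with revPos-cases j q
  ... | inj₁ (t , e) rewrite revPos-inside j q t e = revPos-inside j t q (trans (cong suc (+-comm t q)) e)
  ... | inj₂ 2j≤q    rewrite revPos-outside j q 2j≤q = revPos-outside j q 2j≤q

  revPos-< : ∀ j N q → 2 * j < N → q < N → revPos j q < N
  revPos-< j N zero    2j<N q<N = q<N
  revPos-< j N (suc q) 2j<N q<N with revPos-cases j q
  ... | inj₁ (t , e) rewrite revPos-inside j q t e =
    ≤-trans (s≤s (≤-trans (s≤s (m≤n+m t q)) (≤-reflexive e))) 2j<N
  ... | inj₂ 2j≤q    rewrite revPos-outside j q 2j≤q = q<N

  at-reverse-prefix : ∀ j A C q → length A ≡ 2 * j →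
    at (0 ∷ reverse A ++ C) q ≡ at (0 ∷ A ++ C) (revPos j q)
  at-reverse-prefix j A C zero    lA = refl
  at-reverse-prefix j A C (suc q) lA with revPos-cases j q
  ... | inj₁ (t , e) rewrite revPos-inside j q t e =
    trans (at-++ˡ (reverse A) C q (subst (q <_) (sym (trans (length-reverse A) lA)) q<2j))
      (trans (at-reverse A q (subst (q <_) (sym lA) q<2j))
        (trans (cong (at A) mirror) (sym (at-++ˡ A C t (subst (t <_) (sym lA) t<2j)))))
    where
    q<2j : q < 2 * j
    q<2j = subst (q <_) e (s≤s (m≤m+n q t))
    t<2j : t < 2 * j
    t<2j = subst (t <_) e (s≤s (m≤n+m t q))
    mirror : length A ∸ suc q ≡ t
    mirror = trans (cong (_∸ suc q) (trans lA (sym e))) (m+n∸m≡n q t)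
  ... | inj₂ 2j≤q rewrite revPos-outside j q 2j≤q =
    trans (cong (at (reverse A ++ C)) (split (reverse A) (length-reverse A)))
      (trans (at-++ʳ (reverse A) C (q ∸ 2 * j))
        (trans (sym (at-++ʳ A C (q ∸ 2 * j))) (cong (at (A ++ C)) (sym (split A refl)))))
    where
    split : ∀ B → length B ≡ length A → q ≡ length B + (q ∸ 2 * j)
    split B lB = trans (sym (m+[n∸m]≡n 2j≤q)) (cong (_+ (q ∸ 2 * j)) (sym (trans lB lA)))

  length-prefixRev : ∀ n j π → length π ≡ n → j ≤ n → length (prefixRev j π) ≡ n
  length-prefixRev n j π lπ j≤n = begin
    length (map -_ (reverse (take j π)) ++ drop j π)
      ≡⟨ length-++ (map -_ (reverse (take j π))) ⟩
    length (map -_ (reverse (take j π))) + length (drop j π)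
      ≡⟨ cong₂ _+_ (trans (length-map -_ (reverse (take j π)))
                          (trans (length-reverse (take j π)) (length-take j π)))
                   (length-drop j π) ⟩
    j ⊓ length π + (length π ∸ j)   ≡⟨ cong (λ z → j ⊓ z + (z ∸ j)) lπ ⟩
    j ⊓ n + (n ∸ j)                 ≡⟨ cong (_+ (n ∸ j)) (m≤n⇒m⊓n≡m j≤n) ⟩
    j + (n ∸ j)                     ≡⟨ m+[n∸m]≡n j≤n ⟩
    n                               ∎
    where open ≡-Reasoning

  at-prefixRev : ∀ n j π → length π ≡ n → j ≤ n → ∀ q →
    at (extend n (prefixRev j π)) q ≡ at (extend n π) (revPos j q)
  at-prefixRev n j π lπ j≤n q = begin
    at (extend n (prefixRev j π)) q
      ≡⟨ cong (λ z → at z q) (extend-≡ n (prefixRev j π)) ⟩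
    at (0 ∷ entries (map -_ (reverse A) ++ B) ++ S) q
      ≡⟨ cong (λ z → at (0 ∷ z ++ S) q)
              (trans (entries-++ (map -_ (reverse A)) B) (cong (_++ entries B) (entries-neg-reverse A))) ⟩
    at (0 ∷ (reverse (entries A) ++ entries B) ++ S) q
      ≡⟨ cong (λ z → at (0 ∷ z) q) (++-assoc (reverse (entries A)) (entries B) S) ⟩
    at (0 ∷ reverse (entries A) ++ (entries B ++ S)) q
      ≡⟨ at-reverse-prefix j (entries A) (entries B ++ S) q length-A ⟩
    at (0 ∷ entries A ++ (entries B ++ S)) (revPos j q)
      ≡⟨ cong (λ z → at (0 ∷ z) (revPos j q)) (sym (++-assoc (entries A) (entries B) S)) ⟩
    at (0 ∷ (entries A ++ entries B) ++ S) (revPos j q)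
      ≡⟨ cong (λ z → at (0 ∷ z ++ S) (revPos j q))
              (trans (sym (entries-++ A B)) (cong entries (take++drop≡id j π))) ⟩
    at (0 ∷ entries π ++ S) (revPos j q)
      ≡⟨ cong (λ z → at z (revPos j q)) (sym (extend-≡ n π)) ⟩
    at (extend n π) (revPos j q) ∎
    where
    open ≡-Reasoning
    A B : List ℤ
    A = take j π
    B = drop j π
    S : List ℕ
    S = suc (2 * n) ∷ []
    length-A : length (entries A) ≡ 2 * j
    length-A = trans (length-entries A)
                 (cong (2 *_) (trans (length-take j π) (trans (cong (j ⊓_) lπ) (m≤n⇒m⊓n≡m j≤n))))

-- All we need
-- to know about π is that π' carries every label 0,…,2n+1; this holds for
-- signed permutations and is preserved by prefix reversals.
module BreakpointGraphs where

  open import Data.Nat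
  open import Data.Nat.Properties
  open import Data.Integer as ℤ using (ℤ; -[1+_]; ∣_∣)
  open import Data.Bool using (_∧_)
  open import Data.Bool.Properties using (∧-identityʳ)
  open import Data.List using (List; []; _∷_; _++_; length; map; upTo)
  open import Data.List.Properties using (length-++; length-map; length-upTo; map-++; upTo-∷ʳ)
  open import Data.List.Membership.Propositional using (_∈_; find; lose)
  open import Data.List.Membership.Propositional.Properties
    using (∈-map⁺; ∈-map⁻; ∈-upTo⁺; ∈-upTo⁻; ∈-concatMap⁺; ∈-concatMap⁻)
  open import Data.List.Relation.Unary.Any using (here; there)
  open import Data.List.Relation.Binary.Permutation.Propositional using (↭-sym)
  open import Data.List.Relation.Binary.Permutation.Propositional.Properties using (∈-resp-↭)
  open import Data.Product using (_×_; _,_; proj₁; proj₂; ∃)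
  open import Data.Sum using (_⊎_; inj₁; inj₂; [_,_]′)
  open import Data.Empty using (⊥-elim)
  open import Relation.Nullary using (yes; no)
  open import Relation.Binary.PropositionalEquality
  open import Relation.Binary.Definitions using (tri<; tri≈; tri>)
  open import Data.Nat.Tactic.RingSolver using (solve-∀)
  open import Defs
  open Booleans
  open Counting
  open Cycles
  open Labels

  V : ℕ → ℕ
  V n = 2 + 2 * n

  blackInv : ∀ n → Involution (V n)
  blackInv n = record
    { apply = pairFlip ; closed = pairFlip-< n ; involutive = λ {p} _ → pairFlip-involutive p }

  -- π' carries each label 0,…,2n+1 (and, by counting, exactly once)
  record WellLabelled (n : ℕ) (π : List ℤ) : Set where
    field
      length-π : length π ≡ n
      bounded  : ∀ p → p < V n → at (extend n π) p < V n
      onto     : ∀ l → l < V n → ∃ λ p → p < V n × at (extend n π) p ≡ l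

  module Grey {n : ℕ} {π : List ℤ} (wl : WellLabelled n π) where

    open WellLabelled wl

    π' : List ℕ
    π' = extend n π

    labels-injective : ∀ p q → p < V n → q < V n → at π' p ≡ at π' q → p ≡ q
    labels-injective = surjective⇒injective (V n) (at π') onto

    length-π' : length π' ≡ V n
    length-π' = trans (cong length (extend-≡ n π))
      (cong suc (trans (length-++ (entries π))
        (trans (cong (_+ 1) (trans (length-entries π) (cong (2 *_) length-π))) (+-comm (2 * n) 1))))

    indexOf-at : ∀ q → q < V n → indexOf (at π' q) π' ≡ q
    indexOf-at q q<V with indexOf-first π' (at π' q) q (subst (q <_) (sym length-π') q<V) refl
    ... | i≤q , found = labels-injective _ q (≤-trans (s≤s i≤q) q<V) q<V found

    grey : ℕ → ℕ
    grey p = indexOf (pairFlip (at π' p)) π'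

    grey-spec : ∀ p → p < V n → grey p < V n × at π' (grey p) ≡ pairFlip (at π' p)
    grey-spec p p<V with onto (pairFlip (at π' p)) (pairFlip-< n (bounded p p<V))
    ... | q , q<V , at-q = subst (_< V n) (sym grey≡q) q<V , trans (cong (at π') grey≡q) at-q
      where
      grey≡q : grey p ≡ q
      grey≡q = trans (cong (λ z → indexOf z π') (sym at-q)) (indexOf-at q q<V)

    grey-unique : ∀ p q → p < V n → q < V n → at π' q ≡ pairFlip (at π' p) → grey p ≡ q
    grey-unique p q p<V q<V e =
      labels-injective _ q (proj₁ (grey-spec p p<V)) q<V (trans (proj₂ (grey-spec p p<V)) (sym e))

    greyInv : Involution (V n)
    greyInv = record
      { apply      = grey
      ; closed     = λ {p} p<V → proj₁ (grey-spec p p<V)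
      ; involutive = λ {p} p<V →
          trans (cong (λ z → indexOf (pairFlip z) π') (proj₂ (grey-spec p p<V)))
                (trans (cong (λ z → indexOf z π') (pairFlip-involutive (at π' p))) (indexOf-at p p<V))
      }

    module G = AlternatingCycles (blackInv n) greyInv

    isCycleRep-≡ : ∀ p → BG.isCycleRep n π p ≡ G.isCycleRep p
    isCycleRep-≡ p =
      allᵇ-cong (upTo (V n)) (λ m → cong (λ z → (p ≤ᵇ z) ∧ (p ≤ᵇ pairFlip z)) (σ^-≡ m))
      where
      σ^-≡ : ∀ m → BG.σ^ n π m p ≡ G.σ^ m p
      σ^-≡ zero    = refl
      σ^-≡ (suc m) = cong (λ z → grey (pairFlip z)) (σ^-≡ m)

    c-≡ : BG.c n π ≡ G.cycles
    c-≡ = trans (count-filter (V n) (BG.isCycleRep n π))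
      (count-ext (V n) _ _ (λ p _ → trans (isCycleRep-≡ p) (sym (∧-identityʳ (G.isCycleRep p)))))

    c₁-≡ : BG.c₁ n π ≡ G.cycles₁
    c₁-≡ = trans (count-filter (V n) (λ p → BG.isCycleRep n π p ∧ BG.isLength1 n π p))
                 (count-ext (V n) _ _ (λ p _ → cong (_∧ G.isLength1 p) (isCycleRep-≡ p)))

  ⌈2k/2⌉ : ∀ k → ⌈ 2 * k /2⌉ ≡ k
  ⌈2k/2⌉ k = trans (cong ⌈_/2⌉ (2*-≡-+ k)) (sym (n≡⌈n+n/2⌉ k))

  ⌈2k+1/2⌉ : ∀ k → ⌈ suc (2 * k) /2⌉ ≡ suc k
  ⌈2k+1/2⌉ k = cong suc (trans (cong ⌊_/2⌋ (2*-≡-+ k)) (sym (n≡⌊n+n/2⌋ k)))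

  2[k+1]∸1 : ∀ k → 2 * suc k ∸ 1 ≡ suc (2 * k)
  2[k+1]∸1 k = +-suc k (k + 0)

  ⌈2k∸1/2⌉ : ∀ k → ⌈ 2 * k ∸ 1 /2⌉ ≡ k
  ⌈2k∸1/2⌉ zero    = refl
  ⌈2k∸1/2⌉ (suc k) = trans (cong ⌈_/2⌉ (2[k+1]∸1 k)) (⌈2k+1/2⌉ k)

  label-half : ∀ l → l ≡ 2 * ⌈ l /2⌉ ⊎ l ≡ 2 * ⌈ l /2⌉ ∸ 1
  label-half l with even-or-odd l
  ... | i , inj₁ refl = inj₁ (cong (2 *_) (sym (⌈2k/2⌉ i)))
  ... | i , inj₂ refl = inj₂ (trans (sym (2[k+1]∸1 i)) (cong (λ z → 2 * z ∸ 1) (sym (⌈2k+1/2⌉ i))))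

  l≤2⌈l/2⌉ : ∀ l → l ≤ 2 * ⌈ l /2⌉
  l≤2⌈l/2⌉ l with label-half l
  ... | inj₁ even = ≤-reflexive even
  ... | inj₂ odd  = ≤-trans (≤-reflexive odd) (m∸n≤m _ 1)

  ∈-entry⇒ : ∀ y {l} → l ∈ entry y → ⌈ l /2⌉ ≡ ∣ y ∣
  ∈-entry⇒ (ℤ.+ k)  (here refl)         = ⌈2k∸1/2⌉ k
  ∈-entry⇒ (ℤ.+ k)  (there (here refl)) = ⌈2k/2⌉ k
  ∈-entry⇒ -[1+ k ] (here refl)         = ⌈2k/2⌉ (suc k)
  ∈-entry⇒ -[1+ k ] (there (here refl)) = ⌈2k∸1/2⌉ (suc k)

  ∈-entry⇐ : ∀ y l → ⌈ l /2⌉ ≡ ∣ y ∣ → l ∈ entry y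
  ∈-entry⇐ (ℤ.+ k)  l half with label-half l
  ... | inj₁ even rewrite half = there (here even)
  ... | inj₂ odd  rewrite half = here odd
  ∈-entry⇐ -[1+ k ] l half with label-half l
  ... | inj₁ even rewrite half = here even
  ... | inj₂ odd  rewrite half = there (here odd)

  at-∈ : ∀ xs q → q < length xs → at xs q ∈ xs
  at-∈ (x ∷ xs) zero    _         = here refl
  at-∈ (x ∷ xs) (suc q) (s≤s q<l) = there (at-∈ xs q q<l)

  ∈⇒at : ∀ {x} xs → x ∈ xs → ∃ λ q → q < length xs × at xs q ≡ x
  ∈⇒at (y ∷ xs) (here refl) = 0 , s≤s z≤n , refl
  ∈⇒at (y ∷ xs) (there x∈)  = let (q , q<l , e) = ∈⇒at xs x∈ in suc q , s≤s q<l , e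

  at-extend-inner : ∀ n π → length π ≡ n → ∀ r → r < 2 * n → at (extend n π) (suc r) ≡ at (entries π) r
  at-extend-inner n π lπ r r<2n = trans (cong (λ z → at z (suc r)) (extend-≡ n π))
    (at-++ˡ (entries π) _ r (subst (r <_) (sym (trans (length-entries π) (cong (2 *_) lπ))) r<2n))

  at-extend-last : ∀ n π → length π ≡ n → at (extend n π) (suc (2 * n)) ≡ suc (2 * n)
  at-extend-last n π lπ = trans (cong (λ z → at z (suc (2 * n))) (extend-≡ n π))
    (subst (λ z → at (entries π ++ suc (2 * n) ∷ []) z ≡ suc (2 * n))
      (trans (+-identityʳ _) (trans (length-entries π) (cong (2 *_) lπ))) (at-++ʳ (entries π) _ 0))

  position-cases : ∀ n p → p < V n → p ≡ 0 ⊎ (∃ λ r → p ≡ suc r × r < 2 * n) ⊎ p ≡ suc (2 * n)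
  position-cases n zero    _   = inj₁ refl
  position-cases n (suc r) p<V with r <? 2 * n
  ... | yes r<2n = inj₂ (inj₁ (r , refl , r<2n))
  ... | no  r≮2n = inj₂ (inj₂ (cong suc (≤-antisym (≤-pred (≤-pred p<V)) (≮⇒≥ r≮2n))))

  signedPerm-wellLabelled : ∀ n π → IsSignedPerm n π → WellLabelled n π
  signedPerm-wellLabelled n π (lπ , _ , perm) = record { length-π = lπ ; bounded = bounded ; onto = onto }
    where
    length-entries-π : length (entries π) ≡ 2 * n
    length-entries-π = trans (length-entries π) (cong (2 *_) lπ)

    ∣entry∣≤n : ∀ {y} → y ∈ π → ∣ y ∣ ≤ n
    ∣entry∣≤n y∈π with ∈-map⁻ suc (∈-resp-↭ perm (∈-map⁺ ∣_∣ y∈π))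
    ... | k , k∈ , e rewrite e = ∈-upTo⁻ k∈

    entry-with : ∀ k → k < n → ∃ λ y → y ∈ π × ∣ y ∣ ≡ suc k
    entry-with k k<n with ∈-map⁻ ∣_∣ (∈-resp-↭ (↭-sym perm) (∈-map⁺ suc (∈-upTo⁺ k<n)))
    ... | y , y∈π , e = y , y∈π , sym e

    bounded : ∀ p → p < V n → at (extend n π) p < V n
    bounded p p<V with position-cases n p p<V
    ... | inj₁ refl = p<V
    ... | inj₂ (inj₂ refl) rewrite at-extend-last n π lπ = p<V
    ... | inj₂ (inj₁ (r , refl , r<2n)) rewrite at-extend-inner n π lπ r r<2n
      with find (∈-concatMap⁻ entry (at-∈ (entries π) r (subst (r <_) (sym length-entries-π) r<2n)))
    ...   | y , y∈π , l∈ = s≤s (≤-trans label≤2n (n≤1+n _))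
      where
      l : ℕ
      l = at (entries π) r
      label≤2n : l ≤ 2 * n
      label≤2n = ≤-trans (l≤2⌈l/2⌉ l) (*-monoʳ-≤ 2 (subst (_≤ n) (sym (∈-entry⇒ y l∈)) (∣entry∣≤n y∈π)))

    onto : ∀ l → l < V n → ∃ λ p → p < V n × at (extend n π) p ≡ l
    onto l l<V with position-cases n l l<V
    ... | inj₁ refl = 0 , l<V , refl
    ... | inj₂ (inj₂ refl) = suc (2 * n) , l<V , at-extend-last n π lπ
    ... | inj₂ (inj₁ (r , refl , r<2n))
      with entry-with ⌊ r /2⌋ (≤-trans (⌈n/2⌉-mono r<2n) (≤-reflexive (⌈2k/2⌉ n)))
    ...   | y , y∈π , ∣y∣
      with ∈⇒at (entries π) (∈-concatMap⁺ entry (lose y∈π (∈-entry⇐ y (suc r) (sym ∣y∣))))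
    ...     | q , q<l , at-q = suc q , s≤s (≤-trans q<2n (n≤1+n _)) ,
                               trans (at-extend-inner n π lπ q q<2n) at-q
      where
      q<2n : q < 2 * n
      q<2n = subst (q <_) length-entries-π q<l

  -- ρ̄(1,j) permutes the positions of π', so it keeps π well labelled
  prefixRev-wellLabelled : ∀ {n π} j → j ≤ n → WellLabelled n π → WellLabelled n (prefixRev j π)
  prefixRev-wellLabelled {n} {π} j j≤n wl = record
    { length-π = length-prefixRev n j π length-π j≤n
    ; bounded  = λ p p<V → subst (_< V n) (sym (at-prefixRev n j π length-π j≤n p))
                             (bounded _ (revPos-< j (V n) p 2j<V p<V))
    ; onto     = onto'
    }
    where
    open WellLabelled wl
    2j<V : 2 * j < V n
    2j<V = s≤s (≤-trans (*-monoʳ-≤ 2 j≤n) (n≤1+n _))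
    onto' : ∀ l → l < V n → ∃ λ p → p < V n × at (extend n (prefixRev j π)) p ≡ l
    onto' l l<V with onto l l<V
    ... | p , p<V , at-p = revPos j p , revPos-< j (V n) p 2j<V p<V ,
          trans (at-prefixRev n j π length-π j≤n (revPos j p))
                (trans (cong (at (extend n π)) (revPos-involutive j p)) at-p)

  ℕ→ℤ : ℕ → ℤ
  ℕ→ℤ k = ℤ.+ k

  ι-snoc : ∀ n → ι (suc n) ≡ ι n ++ (ℤ.+ suc n ∷ [])
  ι-snoc n = trans (cong (λ z → map ℕ→ℤ (map suc z)) (sym (upTo-∷ʳ n)))
    (trans (cong (map ℕ→ℤ) (map-++ suc (upTo n) (n ∷ []))) (map-++ ℕ→ℤ (map suc (upTo n)) (suc n ∷ [])))

  length-ι : ∀ n → length (ι n) ≡ n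
  length-ι n = trans (length-map ℕ→ℤ (map suc (upTo n))) (trans (length-map suc (upTo n)) (length-upTo n))

  -- entries (ι (n+1)) = entries (ι n) ++ (2n+1 ∷ 2n+2 ∷ [])
  at-entries-ι : ∀ n r → r < 2 * n → at (entries (ι n)) r ≡ suc r
  at-entries-ι (suc n) r r<2n+2 =
    trans (cong (λ z → at z r) (trans (cong entries (ι-snoc n)) (entries-++ (ι n) last))) (split r r<2n+2)
    where
    E : List ℕ
    E = entries (ι n)
    last : List ℤ
    last = ℤ.+ suc n ∷ []
    length-E : length E ≡ 2 * n
    length-E = trans (length-entries (ι n)) (cong (2 *_) (length-ι n))
    split : ∀ r → r < 2 * suc n → at (E ++ entries last) r ≡ suc r
    split r r<2n+2 with r <? 2 * n
    ... | yes r<2n = trans (at-++ˡ E _ r (subst (r <_) (sym length-E) r<2n)) (at-entries-ι n r r<2n)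
    ... | no  r≮2n with m≤n⇒m<n∨m≡n (≤-pred (subst (r <_) (*-suc 2 n) r<2n+2))
    ...   | inj₂ refl = trans (cong (at (E ++ _)) (sym (trans (+-comm (length E) 1) (cong suc length-E))))
                          (trans (at-++ʳ E _ 1) (*-suc 2 n))
    ...   | inj₁ r<2n+1 with m≤n⇒m<n∨m≡n (≤-pred r<2n+1)
    ...     | inj₁ r<2n = ⊥-elim (r≮2n r<2n)
    ...     | inj₂ refl = trans (cong (at (E ++ _)) (sym (trans (+-identityʳ _) length-E)))
                            (trans (at-++ʳ E _ 0) (2[k+1]∸1 n))

  at-ι : ∀ n q → q < V n → at (extend n (ι n)) q ≡ q
  at-ι n q q<V with position-cases n q q<V
  ... | inj₁ refl = refl
  ... | inj₂ (inj₁ (r , refl , r<2n)) =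
    trans (at-extend-inner n (ι n) (length-ι n) r r<2n) (at-entries-ι n r r<2n)
  ... | inj₂ (inj₂ refl) = at-extend-last n (ι n) (length-ι n)

  ι-wellLabelled : ∀ n → WellLabelled n (ι n)
  ι-wellLabelled n = record
    { length-π = length-ι n
    ; bounded  = λ p p<V → subst (_< V n) (sym (at-ι n p p<V)) p<V
    ; onto     = λ l l<V → l , l<V , at-ι n l l<V
    }

  revPos-mirror : ∀ j a b → suc a + suc b ≡ j →
    revPos j (2 * suc a) ≡ suc (2 * suc b) × revPos j (suc (2 * suc a)) ≡ 2 * suc b
  revPos-mirror j a b j≡ =
    trans (cong (revPos j) (*-suc 2 a)) (revPos-inside j (suc (2 * a)) (2 * suc b) (trans (sum₁ a b) 2[a+b]≡2j)) ,
    trans (revPos-inside j (2 * suc a) (suc (2 * b)) (trans (sum₂ a b) 2[a+b]≡2j)) (sym (*-suc 2 b))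
    where
    2[a+b]≡2j : 2 * (suc a + suc b) ≡ 2 * j
    2[a+b]≡2j = cong (2 *_) j≡
    sum₁ : ∀ a b → suc (suc (2 * a) + 2 * suc b) ≡ 2 * (suc a + suc b)
    sum₁ = solve-∀
    sum₂ : ∀ a b → suc (2 * suc a + suc (2 * b)) ≡ 2 * (suc a + suc b)
    sum₂ = solve-∀

  -- hence revPos j maps the black edge {2i, 2i+1} to a black edge when
  -- 0 < i < j, and fixes it when i > j: only {0,1} and {2j, 2j+1} are broken
  revPos-black : ∀ j q → q ≢ 0 → q ≢ 1 → q ≢ 2 * j → q ≢ suc (2 * j) →
    pairFlip q ≡ revPos j (pairFlip (revPos j q))
  revPos-black j q q≢0 q≢1 q≢2j q≢2j+1 with even-or-odd q
  ... | zero , inj₁ refl = ⊥-elim (q≢0 refl)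
  ... | zero , inj₂ refl = ⊥-elim (q≢1 refl)
  ... | suc a , q≡ with <-cmp (suc a) j
  ...   | tri≈ _ refl _ = ⊥-elim ([ q≢2j , q≢2j+1 ]′ q≡)
  ...   | tri> _ _ j<a+1 = beyond q≡
    where
    2j<2a+2 : 2 * j < 2 * suc a
    2j<2a+2 = *-monoʳ-< 2 j<a+1
    fixed : ∀ p → 2 * j < p → revPos j p ≡ p
    fixed (suc p) 2j<p = revPos-outside j p (≤-pred 2j<p)
    both-fixed : ∀ q → 2 * j < q → 2 * j < pairFlip q → pairFlip q ≡ revPos j (pairFlip (revPos j q))
    both-fixed q 2j<q 2j<q' =
      sym (trans (cong (λ z → revPos j (pairFlip z)) (fixed q 2j<q)) (fixed (pairFlip q) 2j<q'))
    beyond : q ≡ 2 * suc a ⊎ q ≡ suc (2 * suc a) → pairFlip q ≡ revPos j (pairFlip (revPos j q))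
    beyond (inj₁ refl) = both-fixed _ 2j<2a+2
      (subst (2 * j <_) (sym (pairFlip-even (suc a))) (≤-trans 2j<2a+2 (n≤1+n _)))
    beyond (inj₂ refl) = both-fixed _ (≤-trans 2j<2a+2 (n≤1+n _))
      (subst (2 * j <_) (sym (pairFlip-odd (suc a))) 2j<2a+2)
  ...   | tri< a+1<j _ _ = mirrored q≡
    where
    b : ℕ
    b = j ∸ suc (suc a)
    j≡ : suc a + suc b ≡ j
    j≡ = trans (cong (suc a +_) (sym (+-∸-assoc 1 a+1<j))) (m+[n∸m]≡n (<⇒≤ a+1<j))
    image-a : revPos j (2 * suc a) ≡ suc (2 * suc b) × revPos j (suc (2 * suc a)) ≡ 2 * suc b
    image-a = revPos-mirror j a b j≡
    image-b : revPos j (2 * suc b) ≡ suc (2 * suc a) × revPos j (suc (2 * suc b)) ≡ 2 * suc a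
    image-b = revPos-mirror j b a (trans (+-comm (suc b) (suc a)) j≡)
    mirrored : q ≡ 2 * suc a ⊎ q ≡ suc (2 * suc a) → pairFlip q ≡ revPos j (pairFlip (revPos j q))
    mirrored (inj₁ refl) = begin
      pairFlip (2 * suc a)                        ≡⟨ pairFlip-even (suc a) ⟩
      suc (2 * suc a)                             ≡⟨ sym (proj₁ image-b) ⟩
      revPos j (2 * suc b)                        ≡⟨ cong (revPos j) (sym (pairFlip-odd (suc b))) ⟩
      revPos j (pairFlip (suc (2 * suc b)))       ≡⟨ cong (λ z → revPos j (pairFlip z)) (sym (proj₁ image-a)) ⟩
      revPos j (pairFlip (revPos j (2 * suc a)))  ∎
      where open ≡-Reasoning
    mirrored (inj₂ refl) = begin
      pairFlip (suc (2 * suc a))                        ≡⟨ pairFlip-odd (suc a) ⟩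
      2 * suc a                                         ≡⟨ sym (proj₂ image-b) ⟩
      revPos j (suc (2 * suc b))                        ≡⟨ cong (revPos j) (sym (pairFlip-even (suc b))) ⟩
      revPos j (pairFlip (2 * suc b))                   ≡⟨ cong (λ z → revPos j (pairFlip z)) (sym (proj₂ image-a)) ⟩
      revPos j (pairFlip (revPos j (suc (2 * suc a))))  ∎
      where open ≡-Reasoning

module Sorting where

  open import Data.Nat
  open import Data.Nat.Properties
  open import Data.Integer as ℤ using (ℤ)
  import Data.Integer.Properties as ℤ
  open import Data.Integer.Tactic.RingSolver as ℤ-Solver using ()
  open import Data.Bool using (true; _∧_)
  open import Data.Bool.Properties using (∧-identityʳ)
  open import Data.List using (List; []; _∷_; length)
  open import Data.List.Relation.Unary.All using (All; []; _∷_)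
  open import Data.Product using (_×_; _,_; proj₁; proj₂; ∃)
  open import Relation.Nullary using (yes; no)
  open import Relation.Binary.PropositionalEquality
  open import Data.Nat.Tactic.RingSolver using (solve-∀)
  open import Defs
  open Booleans
  open Counting
  open Cycles
  open Relabelling
  open BlackSwap
  open Labels
  open BreakpointGraphs

  z : ℕ → List ℤ → ℕ
  z n π = 𝟙 (BG.isLength1 n π 0)

  -- BG(ρ̄(1,j) π) is, after relabelling the vertices by revPos j, the graph
  -- BG(π) with the black edges {0,1},{2j,2j+1} exchanged for {0,2j},{1,2j+1}.
  module Step {n : ℕ} {π : List ℤ} (wl : WellLabelled n π) (j' : ℕ) (j≤n : suc j' ≤ n) where

    j : ℕ
    j = suc j'
    π₂ : List ℤ
    π₂ = prefixRev j π
    wl₂ : WellLabelled n π₂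
    wl₂ = prefixRev-wellLabelled j j≤n wl
    module B₁ = Grey wl
    module B₂ = Grey wl₂
    open WellLabelled wl using (length-π)

    2j<V : 2 * j < V n
    2j<V = s≤s (≤-trans (*-monoʳ-≤ 2 j≤n) (n≤1+n _))

    f : Involution (V n)
    f = record
      { apply      = revPos j
      ; closed     = λ {p} → revPos-< j (V n) p 2j<V
      ; involutive = λ {p} _ → revPos-involutive j p
      }

    -- the black edges of BG(ρ̄(1,j) π), pulled back along revPos j
    black' : Involution (V n)
    black' = record
      { apply      = λ p → revPos j (pairFlip (revPos j p))
      ; closed     = λ p<V → Involution.closed f (pairFlip-< n (Involution.closed f p<V))
      ; involutive = λ {p} p<V →
          trans (cong (λ z → revPos j (pairFlip z)) (revPos-involutive j (pairFlip (revPos j p))))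
                (trans (cong (revPos j) (pairFlip-involutive (revPos j p))) (revPos-involutive j p))
      }

    grey-relabel : ∀ {p} → p < V n → B₂.grey p ≡ revPos j (B₁.grey (revPos j p))
    grey-relabel {p} p<V = B₂.grey-unique p _ p<V (revPos-< j (V n) _ 2j<V (proj₁ (B₁.grey-spec _ fp<V))) labels
      where
      fp<V : revPos j p < V n
      fp<V = revPos-< j (V n) p 2j<V p<V
      q : ℕ
      q = B₁.grey (revPos j p)
      labels : at B₂.π' (revPos j q) ≡ pairFlip (at B₂.π' p)
      labels = begin
        at B₂.π' (revPos j q)               ≡⟨ at-prefixRev n j π length-π j≤n (revPos j q) ⟩
        at B₁.π' (revPos j (revPos j q))    ≡⟨ cong (at B₁.π') (revPos-involutive j q) ⟩
        at B₁.π' q                          ≡⟨ proj₂ (B₁.grey-spec (revPos j p) fp<V) ⟩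
        pairFlip (at B₁.π' (revPos j p))    ≡⟨ cong pairFlip (sym (at-prefixRev n j π length-π j≤n p)) ⟩
        pairFlip (at B₂.π' p)               ∎
        where open ≡-Reasoning

    module Iso = Isomorphic black' B₁.greyInv (blackInv n) B₂.greyInv f
      (λ {p} _ → sym (trans (revPos-involutive j (pairFlip (revPos j (revPos j p))))
                            (cong pairFlip (revPos-involutive j p))))
      grey-relabel

    module Sw = Swap (blackInv n) black' B₁.greyInv (2 * j)
      (s≤s (s≤s (*-monoʳ-≤ 2 j≤n)))
      (≤-trans (s≤s (s≤s z≤n)) (≤-reflexive (sym (*-suc 2 j'))))
      refl (pairFlip-even j)
      refl (trans (cong (revPos j) (pairFlip-even j)) (revPos-outside j (2 * j) ≤-refl))
      (λ q _ q≢0 q≢1 q≢2j q≢2j+1 → revPos-black j q q≢0 q≢1 q≢2j q≢2j+1)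

    step : BG.c n π + 2 * BG.c₁ n π₂ + 2 * z n π ≤ BG.c n π₂ + 2 * BG.c₁ n π + 2 * z n π₂ + 1
    step = begin
      BG.c n π + 2 * BG.c₁ n π₂ + 2 * z n π
        ≡⟨ cong₂ (λ c c₁ → c + 2 * c₁ + 2 * z n π) B₁.c-≡ (trans B₂.c₁-≡ Iso.cycles₁-≡) ⟩
      Sw.S.cycles + 2 * Sw.M.cycles₁ + 2 * 𝟙 (Sw.S.isLength1 0)
        ≤⟨ Sw.swap-inequality ⟩
      Sw.M.cycles + 2 * Sw.S.cycles₁ + 2 * 𝟙 (Sw.M.isLength1 0) + 1
        ≡⟨ cong₂ (λ c l → c + 2 * Sw.S.cycles₁ + 2 * 𝟙 l + 1)
                 (sym (trans B₂.c-≡ Iso.cycles-≡)) (sym (Iso.isLength1-relabel (s≤s z≤n))) ⟩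
      BG.c n π₂ + 2 * Sw.S.cycles₁ + 2 * z n π₂ + 1
        ≡⟨ cong (λ c₁ → BG.c n π₂ + 2 * c₁ + 2 * z n π₂ + 1) (sym B₁.c₁-≡) ⟩
      BG.c n π₂ + 2 * BG.c₁ n π + 2 * z n π₂ + 1 ∎
      where open ≤-Reasoning

  -- In BG(ι) every grey edge is parallel to a black edge: all n + 1 cycles
  -- have length one, and so does the cycle through 0.
  module Identity (n : ℕ) where

    module B = Grey (ι-wellLabelled n)

    σ-identity : ∀ p → p < V n → B.G.σ p ≡ p
    σ-identity p p<V = trans grey-pairFlip (pairFlip-involutive p)
      where
      p'<V : pairFlip p < V n
      p'<V = pairFlip-< n p<V
      grey-pairFlip : B.grey (pairFlip p) ≡ pairFlip (pairFlip p)
      grey-pairFlip = B.grey-unique (pairFlip p) _ p'<V (pairFlip-< n p'<V)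
        (trans (at-ι n _ (pairFlip-< n p'<V)) (cong pairFlip (sym (at-ι n _ p'<V))))

    σ^-identity : ∀ m p → p < V n → B.G.σ^ m p ≡ p
    σ^-identity zero    p p<V = refl
    σ^-identity (suc m) p p<V = trans (cong B.G.σ (σ^-identity m p p<V)) (σ-identity p p<V)

    isLength1-all : ∀ p → p < V n → B.G.isLength1 p ≡ true
    isLength1-all p p<V = subst (λ q → (q ≡ᵇ p) ≡ true) (sym (σ-identity p p<V)) (≡ᵇ-refl p)

    cycles₁≡cycles : B.G.cycles₁ ≡ B.G.cycles
    cycles₁≡cycles = count-ext (V n) _ _ (λ p p<V → cong (B.G.isCycleRep p ∧_) (isLength1-all p p<V))

    even-isCycleRep : ∀ i → i ≤ n → B.G.isCycleRep (2 * i) ≡ true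
    even-isCycleRep i i≤n = allᵇ-intro (V n) _ (λ m _ →
      ∧-intro (≤ᵇ-complete (≤-reflexive (sym (σ^-identity m _ 2i<V))))
              (≤ᵇ-complete (≤-trans (n≤1+n _)
                 (≤-reflexive (sym (trans (cong pairFlip (σ^-identity m _ 2i<V)) (pairFlip-even i)))))))
      where
      2i<V : 2 * i < V n
      2i<V = s≤s (≤-trans (*-monoʳ-≤ 2 i≤n) (n≤1+n _))

    n+1≤cycles : suc n ≤ B.G.cycles
    n+1≤cycles = subst (_≤ B.G.cycles) (count-all (suc n))
      (count-injection (suc n) (V n) (λ _ → true) _ (2 *_)
        (λ i i<n+1 _ → s≤s (≤-trans (*-monoʳ-≤ 2 (≤-pred i<n+1)) (n≤1+n _)) ,
                       trans (∧-identityʳ _) (even-isCycleRep i (≤-pred i<n+1)))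
        (λ a b _ _ _ _ e → *-cancelˡ-≡ a b 2 e))

    identity-bound : n + 1 + BG.c n (ι n) + 2 * z n (ι n) ≤ 0 + 2 * BG.c₁ n (ι n) + 2
    identity-bound = begin
      n + 1 + BG.c n (ι n) + 2 * z n (ι n)
        ≡⟨ cong₂ (λ c l → n + 1 + c + 2 * 𝟙 l) B.c-≡ (isLength1-all 0 (s≤s z≤n)) ⟩
      n + 1 + B.G.cycles + 2
        ≤⟨ +-monoˡ-≤ 2 (+-monoˡ-≤ B.G.cycles (≤-trans (≤-reflexive (+-comm n 1)) n+1≤cycles)) ⟩
      B.G.cycles + B.G.cycles + 2
        ≡⟨ cong (_+ 2) (sym (2*-≡-+ B.G.cycles)) ⟩
      2 * B.G.cycles + 2
        ≡⟨ cong (λ c₁ → 2 * c₁ + 2) (sym (trans B.c₁-≡ cycles₁≡cycles)) ⟩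
      0 + 2 * BG.c₁ n (ι n) + 2 ∎
      where open ≤-Reasoning

  potential-step : ∀ a L c c₂ c₁ c₁₂ z z₂ →
    c + 2 * c₁₂ + 2 * z ≤ c₂ + 2 * c₁ + 2 * z₂ + 1 →
    a + c₂ + 2 * z₂ ≤ L + 2 * c₁₂ + 2 →
    a + c + 2 * z ≤ suc L + 2 * c₁ + 2
  potential-step a L c c₂ c₁ c₁₂ z z₂ step bound = +-cancelʳ-≤ (2 * c₁₂) _ _ (begin
    a + c + 2 * z + 2 * c₁₂           ≡⟨ e₁ a c c₁₂ z ⟩
    a + (c + 2 * c₁₂ + 2 * z)         ≤⟨ +-monoʳ-≤ a step ⟩
    a + (c₂ + 2 * c₁ + 2 * z₂ + 1)    ≡⟨ e₂ a c₂ c₁ z₂ ⟩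
    (a + c₂ + 2 * z₂) + (2 * c₁ + 1)  ≤⟨ +-monoˡ-≤ (2 * c₁ + 1) bound ⟩
    (L + 2 * c₁₂ + 2) + (2 * c₁ + 1)  ≡⟨ e₃ L c₁₂ c₁ ⟩
    suc L + 2 * c₁ + 2 + 2 * c₁₂      ∎)
    where
    open ≤-Reasoning
    e₁ : ∀ a c c₁₂ z → a + c + 2 * z + 2 * c₁₂ ≡ a + (c + 2 * c₁₂ + 2 * z)
    e₁ = solve-∀
    e₂ : ∀ a c₂ c₁ z₂ → a + (c₂ + 2 * c₁ + 2 * z₂ + 1) ≡ (a + c₂ + 2 * z₂) + (2 * c₁ + 1)
    e₂ = solve-∀
    e₃ : ∀ L c₁₂ c₁ → (L + 2 * c₁₂ + 2) + (2 * c₁ + 1) ≡ suc L + 2 * c₁ + 2 + 2 * c₁₂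
    e₃ = solve-∀

  sorting-bound : ∀ n π js → WellLabelled n π → All (λ j → 1 ≤ j × j ≤ n) js → applyAll js π ≡ ι n →
    n + 1 + BG.c n π + 2 * z n π ≤ length js + 2 * BG.c₁ n π + 2
  sorting-bound n π []             wl []                       refl   = Identity.identity-bound n
  sorting-bound n π (suc j' ∷ js) wl ((s≤s z≤n , j≤n) ∷ valid) sorted =
    potential-step (n + 1) (length js) (BG.c n π) (BG.c n π₂) (BG.c₁ n π) (BG.c₁ n π₂) (z n π) (z n π₂)
      (Step.step wl j' j≤n) (sorting-bound n π₂ js (Step.wl₂ wl j' j≤n) valid sorted)
    where
    π₂ : List ℤ
    π₂ = prefixRev (suc j') π

  -- firstCorr π is + 0 only when π₁ = 1, and then 0 lies on the cycle {0, 1}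
  first-entry : ∀ n π → ∃ λ k → firstCorr π ≡ ℤ.+ k × 2 ≤ k + 2 * z n π
  first-entry n []       = 2 , refl , m≤m+n 2 _
  first-entry n (x ∷ ys) with x ℤ.≟ ℤ.+ 1
  ... | yes refl = 0 , refl , ≤-refl
  ... | no  _    = 2 , refl , m≤m+n 2 _

  lowerBound-≤ : ∀ n π L → n + 1 + BG.c n π + 2 * z n π ≤ L + 2 * BG.c₁ n π + 2 →
    lowerBound n π ℤ.≤ ℤ.+ L
  lowerBound-≤ n π L bound with first-entry n π
  ... | k , corr≡ , 2≤k+2z rewrite corr≡ =
    ℤ.≤-trans (ℤ.+-monoˡ-≤ (ℤ.- ℤ.+ k) (ℤ.+-monoˡ-≤ (ℤ.- ℤ.+ (2 * c₁)) (ℤ.+≤+ without-z)))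
              (ℤ.≤-reflexive cancel)
    where
    c₁ : ℕ
    c₁ = BG.c₁ n π
    without-z : n + 1 + BG.c n π ≤ L + 2 * c₁ + k
    without-z = +-cancelʳ-≤ (2 * z n π) _ _ (≤-trans bound
      (≤-trans (+-monoʳ-≤ (L + 2 * c₁) 2≤k+2z) (≤-reflexive (sym (+-assoc (L + 2 * c₁) k (2 * z n π))))))
    cancel : ℤ.+ (L + 2 * c₁ + k) ℤ.- ℤ.+ (2 * c₁) ℤ.- ℤ.+ k ≡ ℤ.+ L
    cancel = trans (cong (λ w → w ℤ.- ℤ.+ (2 * c₁) ℤ.- ℤ.+ k)
                     (trans (ℤ.pos-+ (L + 2 * c₁) k) (cong (ℤ._+ ℤ.+ k) (ℤ.pos-+ L (2 * c₁)))))
                   (rearrange (ℤ.+ L) (ℤ.+ (2 * c₁)) (ℤ.+ k))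
      where
      rearrange : ∀ (d b e : ℤ) → d ℤ.+ b ℤ.+ e ℤ.- b ℤ.- e ≡ d
      rearrange = ℤ-Solver.solve-∀

open import Defs
open import Data.Nat using (ℕ)
open import Data.Integer using (ℤ; +_; _≤_)
open import Data.List using (List; length)
open import Data.Product using (_,_)
open BreakpointGraphs using (signedPerm-wellLabelled)
open Sorting using (sorting-bound; lowerBound-≤)

theorem2 : (n : ℕ) (π : List ℤ) → IsSignedPerm n π →
    (js : List ℕ) → IsSortingSeq n π js →
    lowerBound n π ≤ + length js
theorem2 n π isp js (valid , sorted) =
  lowerBound-≤ n π (length js) (sorting-bound n π js (signedPerm-wellLabelled n π isp) valid sorted)
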